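{- Let $n\geq 3$. Then $mp_s(Q_n)=2n-2$ for all integers $s\geq 2$.
   Context: The $n$-dimensional hypercube $Q_n$ has vertex set all binary strings $v_1v_2\ldots v_n$ with $v_i\in\{0,1\}$, two vertices being adjacent iff their strings differ in exactly one position. A perfect matching covers all vertices; an almost perfect matching covers all but one vertex. For a nonnegative integer $s$ and a graph $G$, a set $F\subseteq E(G)$ is an $s$-restricted matching preclusion set of $G$ if $G-F$ has neither a perfect matching nor an almost perfect matching, and every connected component of $G-F$ has at least $s+1$ vertices. The $s$-restricted matching preclusion number $mp_s(G)$ is the minimum cardinality of an $s$-restricted matching preclusion set of $G$ (with $mp_s(G)=+\infty$ if none exists or if $G$ has neither a perfect nor an almost perfect matching). -}

module Defs where

open import Data.Nat using (ℕ; zero; suc; _+_; _*_; _∸_; _^_; _≤_; _<_)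
open import Data.Bool using (Bool; true; false)
open import Data.Vec using (Vec; []; _∷_)
open import Data.List using (List; length)
open import Data.List.Membership.Propositional using (_∈_)
open import Data.List.Relation.Unary.All using (All)
open import Data.List.Relation.Unary.Any using (Any)
open import Data.List.Relation.Unary.AllPairs using (AllPairs)
open import Data.List.Relation.Unary.Unique.Propositional using (Unique)
open import Data.Product using (Σ; ∃; ∃-syntax; _×_; _,_)
open import Data.Sum using (_⊎_)
open import Relation.Nullary using (¬_)
open import Relation.Binary.PropositionalEquality using (_≡_; _≢_)
open import Relation.Binary.Construct.Closure.ReflexiveTransitive using (Star)

Vertex : ℕ → Set
Vertex n = Vec Bool n

hamming : ∀ {n} → Vertex n → Vertex n → ℕ
hamming [] [] = 0
hamming (true ∷ u) (true ∷ v) = hamming u v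
hamming (false ∷ u) (false ∷ v) = hamming u v
hamming (true ∷ u) (false ∷ v) = suc (hamming u v)
hamming (false ∷ u) (true ∷ v) = suc (hamming u v)

Adj : ∀ {n} → Vertex n → Vertex n → Set
Adj u v = hamming u v ≡ 1

-- An edge is given by an (ordered) pair of its endpoints; two pairs
-- denote the same (undirected) edge iff they agree up to orientation.
Pair : ℕ → Set
Pair n = Vertex n × Vertex n

SameEdge : ∀ {n} → Pair n → Pair n → Set
SameEdge (a , b) (c , d) = (a ≡ c × b ≡ d) ⊎ (a ≡ d × b ≡ c)

-- A finite set of edges of Q_n, listed without repetition (as undirected edges).
-- Its cardinality is the length of the list.
IsEdgeSet : ∀ {n} → List (Pair n) → Set
IsEdgeSet F = All (λ e → Adj (Data.Product.proj₁ e) (Data.Product.proj₂ e)) F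
            × AllPairs (λ e f → ¬ SameEdge e f) F

AdjMinus : ∀ {n} → List (Pair n) → Vertex n → Vertex n → Set
AdjMinus F u v = Adj u v × ¬ ((u , v) ∈ F ⊎ (v , u) ∈ F)

Incident : ∀ {n} → Vertex n → Pair n → Set
Incident x (a , b) = x ≡ a ⊎ x ≡ b

Disjoint : ∀ {n} → Pair n → Pair n → Set
Disjoint (a , b) (c , d) = a ≢ c × a ≢ d × b ≢ c × b ≢ d

IsMatching : ∀ {n} → List (Pair n) → List (Pair n) → Set
IsMatching F M = All (λ e → AdjMinus F (Data.Product.proj₁ e) (Data.Product.proj₂ e)) M
               × AllPairs Disjoint M

Covered : ∀ {n} → List (Pair n) → Vertex n → Set
Covered M x = Any (Incident x) M

HasPerfectMatching : ∀ {n} → List (Pair n) → Set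
HasPerfectMatching {n} F =
  ∃[ M ] (IsMatching F M × (∀ (x : Vertex n) → Covered M x))

HasAlmostPerfectMatching : ∀ {n} → List (Pair n) → Set
HasAlmostPerfectMatching {n} F =
  ∃[ M ] (IsMatching F M × ∃[ x₀ ] (¬ Covered M x₀ × (∀ (x : Vertex n) → x ≢ x₀ → Covered M x)))

Reach : ∀ {n} → List (Pair n) → Vertex n → Vertex n → Set
Reach F = Star (AdjMinus F)

AllComponentsAtLeast : ∀ {n} → List (Pair n) → ℕ → Set
AllComponentsAtLeast {n} F k =
  ∀ (x : Vertex n) → ∃[ L ] (Unique L × k ≤ length L × All (Reach F x) L)

IsSRMPSet : ∀ n → ℕ → List (Pair n) → Set
IsSRMPSet n s F =
  IsEdgeSet F
  × ¬ HasPerfectMatching F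
  × ¬ HasAlmostPerfectMatching F
  × AllComponentsAtLeast F (suc s)

MpEq : ℕ → ℕ → ℕ → Set
MpEq n s m =
  (∃[ F ] (IsSRMPSet n s F × length F ≡ m))
  × (∀ (F : List (Pair n)) → IsSRMPSet n s F → m ≤ length F)

-- The upper bound: deleting the 2n − 2 edges at two vertices u, v of distance two other than those to a
-- common neighbour w leaves u and v hanging at w alone, so no perfect matching survives, while for n ≥ 3
-- the cube stays connected; an almost perfect matching never exists since 2^n is even.
-- The lower bound is the conditional matching preclusion theorem: if |F| ≤ 2n − 3 and Q_n − F has no
-- isolated vertex, Q_n − F has a perfect matching. Perfect matchings are handled as fixed-point-free
-- involutions along edges, which glue well when Q_n is split along its first coordinate into two copies
-- of Q_(n−1) joined by the cross edges. Induction on n then uses three auxiliary facts: fewer than n faults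
-- leave a perfect matching, at most n − 2 faults leave one through any prescribed fault-free edge, and two
-- vertices isolated in Q_n − F require 2n − 1 faults.
module Submission where

open import Defs
open import Data.Bool using (Bool; true; false; not; _xor_)
open import Data.Bool.Properties using (not-involutive; not-¬) renaming (_≟_ to _≟ᴮ_)
open import Data.Empty using (⊥; ⊥-elim)
open import Data.Fin using (Fin; zero; suc; punchIn; punchOut) renaming (_≟_ to _≟ᶠ_)
open import Data.Fin.Properties using (all?; ¬∀⟶∃¬; punchInᵢ≢i; punchIn-injective; punchIn-punchOut)
open import Data.List using (List; []; _∷_; length; map; filter; _++_; allFin)
import Data.List.Membership.DecPropositional as DecMembership
open import Data.List.Membership.Propositional using (_∈_; lose; find)
open import Data.List.Membership.Propositional.Properties
  using (∈-map⁺; ∈-map⁻; ∈-++⁺ˡ; ∈-++⁺ʳ; ∈-++⁻; ∈-filter⁺; ∈-filter⁻; ∈-allFin)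
open import Data.List.Properties
  using (length-map; length-++; length-tabulate; filter-all; filter-notAll; filter-none; filter-≐)
open import Data.List.Relation.Unary.All as All using (All; []; _∷_)
import Data.List.Relation.Unary.All.Properties as All
open import Data.List.Relation.Unary.AllPairs as AllPairs using (AllPairs; []; _∷_)
import Data.List.Relation.Unary.AllPairs.Properties as AllPairs
open import Data.List.Relation.Unary.Any as Any using (Any; here; there; any?)
import Data.List.Relation.Unary.Any.Properties as Any
open import Data.List.Relation.Unary.Unique.Propositional using (Unique)
import Data.List.Relation.Unary.Unique.Propositional.Properties as Unique
open import Data.Nat using (ℕ; zero; suc; _+_; _*_; _∸_; _^_; _≤_; _<_; z≤n; s≤s; z<s; _≤?_)
open import Data.Nat.Properties
open import Data.Product using (Σ; ∃; ∃₂; _×_; _,_; proj₁; proj₂)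
import Data.Product.Properties as Product
open import Data.Sum using (_⊎_; inj₁; inj₂; [_,_])
open import Data.Unit using (⊤; tt)
open import Data.Vec using (Vec; []; _∷_; head; tail; replicate)
import Data.Vec.Properties as Vec
open import Function using (_∘_; case_of_)
open import Relation.Binary.Construct.Closure.ReflexiveTransitive using (Star; ε; _◅_; _◅◅_; gmap; reverse)
open import Relation.Binary.PropositionalEquality hiding ([_])
open import Relation.Nullary using (¬_; Dec; yes; no; ¬?)
open import Relation.Nullary.Decidable using (_⊎-dec_; _×-dec_)

_≟ⱽ_ : ∀ {n} (x y : Vertex n) → Dec (x ≡ y)
_≟ⱽ_ = Vec.≡-dec _≟ᴮ_

_≟ᴾ_ : ∀ {n} (e f : Pair n) → Dec (e ≡ f)
_≟ᴾ_ = Product.≡-dec _≟ⱽ_ _≟ⱽ_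

toggle : ∀ {n} → Fin n → Vertex n → Vertex n
toggle zero    (b ∷ x) = not b ∷ x
toggle (suc i) (b ∷ x) = b ∷ toggle i x

toggle-involutive : ∀ {n} i (x : Vertex n) → toggle i (toggle i x) ≡ x
toggle-involutive zero    (b ∷ x) = cong (_∷ x) (not-involutive b)
toggle-involutive (suc i) (b ∷ x) = cong (b ∷_) (toggle-involutive i x)

hamming-refl : ∀ {n} (x : Vertex n) → hamming x x ≡ 0
hamming-refl []          = refl
hamming-refl (true ∷ x)  = hamming-refl x
hamming-refl (false ∷ x) = hamming-refl x

hamming-sym : ∀ {n} (x y : Vertex n) → hamming x y ≡ hamming y x
hamming-sym []          []          = refl
hamming-sym (true ∷ x)  (true ∷ y)  = hamming-sym x y
hamming-sym (false ∷ x) (false ∷ y) = hamming-sym x y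
hamming-sym (true ∷ x)  (false ∷ y) = cong suc (hamming-sym x y)
hamming-sym (false ∷ x) (true ∷ y)  = cong suc (hamming-sym x y)

hamming-∷ : ∀ {n} b (x y : Vertex n) → hamming (b ∷ x) (b ∷ y) ≡ hamming x y
hamming-∷ true  x y = refl
hamming-∷ false x y = refl

hamming≡0⇒≡ : ∀ {n} (x y : Vertex n) → hamming x y ≡ 0 → x ≡ y
hamming≡0⇒≡ []          []          _ = refl
hamming≡0⇒≡ (true ∷ x)  (true ∷ y)  h = cong (true ∷_) (hamming≡0⇒≡ x y h)
hamming≡0⇒≡ (false ∷ x) (false ∷ y) h = cong (false ∷_) (hamming≡0⇒≡ x y h)
hamming≡0⇒≡ (true ∷ x)  (false ∷ y) ()
hamming≡0⇒≡ (false ∷ x) (true ∷ y)  ()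

Adj-sym : ∀ {n} {x y : Vertex n} → Adj x y → Adj y x
Adj-sym {x = x} {y} xy = trans (hamming-sym y x) xy

Adj-∷ : ∀ {n} b {x y : Vertex n} → Adj x y → Adj (b ∷ x) (b ∷ y)
Adj-∷ b {x} {y} xy = trans (hamming-∷ b x y) xy

Adj-not∷ : ∀ {n} b (x : Vertex n) → Adj (b ∷ x) (not b ∷ x)
Adj-not∷ true  x = cong suc (hamming-refl x)
Adj-not∷ false x = cong suc (hamming-refl x)

Adj-toggle : ∀ {n} i (x : Vertex n) → Adj x (toggle i x)
Adj-toggle zero    (b ∷ x) = Adj-not∷ b x
Adj-toggle (suc i) (b ∷ x) = Adj-∷ b (Adj-toggle i x)

Adj⇒toggle : ∀ {n} (x y : Vertex n) → Adj x y → ∃ λ i → y ≡ toggle i x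
Adj⇒toggle []          []          ()
Adj⇒toggle (true ∷ x)  (true ∷ y)  xy = let i , y≡ = Adj⇒toggle x y xy in suc i , cong (true ∷_) y≡
Adj⇒toggle (false ∷ x) (false ∷ y) xy = let i , y≡ = Adj⇒toggle x y xy in suc i , cong (false ∷_) y≡
Adj⇒toggle (true ∷ x)  (false ∷ y) xy = zero , cong (false ∷_) (sym (hamming≡0⇒≡ x y (suc-injective xy)))
Adj⇒toggle (false ∷ x) (true ∷ y)  xy = zero , cong (true ∷_) (sym (hamming≡0⇒≡ x y (suc-injective xy)))

Adj⇒≢ : ∀ {n} {x y : Vertex n} → Adj x y → x ≢ y
Adj⇒≢ {x = x} xx refl with () ← trans (sym xx) (hamming-refl x)

toggle-≢ : ∀ {n} i (x : Vertex n) → toggle i x ≢ x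
toggle-≢ i x eq = Adj⇒≢ (Adj-toggle i x) (sym eq)

toggle-injective : ∀ {n} i j (x : Vertex n) → toggle i x ≡ toggle j x → i ≡ j
toggle-injective zero    zero    _       _  = refl
toggle-injective zero    (suc j) (b ∷ x) eq = ⊥-elim (not-¬ refl (sym (cong head eq)))
toggle-injective (suc i) zero    (b ∷ x) eq = ⊥-elim (not-¬ refl (cong head eq))
toggle-injective (suc i) (suc j) (b ∷ x) eq = cong suc (toggle-injective i j x (cong tail eq))

parity : ∀ {n} → Vertex n → Bool
parity []      = false
parity (b ∷ x) = b xor parity x

Adj⇒parity-not : ∀ {n} (x y : Vertex n) → Adj x y → parity y ≡ not (parity x)
Adj⇒parity-not []          []          ()
Adj⇒parity-not (true ∷ x)  (true ∷ y)  xy = cong not (Adj⇒parity-not x y xy)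
Adj⇒parity-not (false ∷ x) (false ∷ y) xy = Adj⇒parity-not x y xy
Adj⇒parity-not (true ∷ x)  (false ∷ y) xy
  rewrite hamming≡0⇒≡ x y (suc-injective xy) = sym (not-involutive (parity y))
Adj⇒parity-not (false ∷ x) (true ∷ y)  xy
  rewrite hamming≡0⇒≡ x y (suc-injective xy) = refl

allVertices : ∀ n → List (Vertex n)
allVertices zero    = [] ∷ []
allVertices (suc n) = map (false ∷_) (allVertices n) ++ map (true ∷_) (allVertices n)

∈-allVertices : ∀ {n} (x : Vertex n) → x ∈ allVertices n
∈-allVertices []                = here refl
∈-allVertices {suc n} (false ∷ x) = ∈-++⁺ˡ (∈-map⁺ (false ∷_) (∈-allVertices x))
∈-allVertices {suc n} (true ∷ x)  = ∈-++⁺ʳ (map (false ∷_) (allVertices n)) (∈-map⁺ (true ∷_) (∈-allVertices x))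

allVertices-unique : ∀ n → Unique (allVertices n)
allVertices-unique zero    = [] ∷ []
allVertices-unique (suc n) =
  Unique.++⁺ (Unique.map⁺ (cong tail) (allVertices-unique n))
             (Unique.map⁺ (cong tail) (allVertices-unique n))
             λ (x∈₀ , x∈₁) → halves-disjoint x∈₀ x∈₁
  where
  halves-disjoint : ∀ {x} → x ∈ map (false ∷_) (allVertices n) → x ∈ map (true ∷_) (allVertices n) → ⊥
  halves-disjoint x∈₀ x∈₁ with ∈-map⁻ (false ∷_) x∈₀ | ∈-map⁻ (true ∷_) x∈₁
  ... | _ , _ , refl | _ , _ , ()

length-allVertices : ∀ n → length (allVertices n) ≡ 2 ^ n
length-allVertices zero    = refl
length-allVertices (suc n) = begin
  length (map (false ∷_) V ++ map (true ∷_) V)  ≡⟨ length-++ (map (false ∷_) V) ⟩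
  length (map (false ∷_) V) + length (map (true ∷_) V)
    ≡⟨ cong₂ _+_ (length-map (false ∷_) V) (length-map (true ∷_) V) ⟩
  length V + length V                            ≡⟨ cong (λ k → k + k) (length-allVertices n) ⟩
  2 ^ n + 2 ^ n                                  ≡⟨ cong (2 ^ n +_) (sym (+-identityʳ (2 ^ n))) ⟩
  2 ^ suc n                                      ∎
  where
  open ≡-Reasoning
  V = allVertices n

Faulty : ∀ {n} → List (Pair n) → Vertex n → Vertex n → Set
Faulty F x y = (x , y) ∈ F ⊎ (y , x) ∈ F

Faulty? : ∀ {n} (F : List (Pair n)) x y → Dec (Faulty F x y)
Faulty? F x y = DecMembership._∈?_ _≟ᴾ_ (x , y) F ⊎-dec DecMembership._∈?_ _≟ᴾ_ (y , x) F

Faulty-sym : ∀ {n} (F : List (Pair n)) {x y} → Faulty F x y → Faulty F y x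
Faulty-sym F (inj₁ xy∈F) = inj₂ xy∈F
Faulty-sym F (inj₂ yx∈F) = inj₁ yx∈F

record MatchingInvolution {n} (F : List (Pair n)) : Set where
  field
    partner    : Vertex n → Vertex n
    involutive : ∀ x → partner (partner x) ≡ x
    adjacent   : ∀ x → Adj x (partner x)
    fault-free : ∀ x → ¬ Faulty F x (partner x)

MatchingThrough : ∀ {n} → List (Pair n) → Vertex n → Vertex n → Set
MatchingThrough F a b = Σ (MatchingInvolution F) λ P → MatchingInvolution.partner P a ≡ b

NoIsolatedVertex : ∀ {n} → List (Pair n) → Set
NoIsolatedVertex {n} F = ∀ (x : Vertex n) → ∃ λ i → ¬ Faulty F x (toggle i x)

All⇒AllPairs : ∀ {A : Set} {P : A → Set} {xs} → All P xs → AllPairs (λ x y → P x × P y) xs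
All⇒AllPairs []         = []
All⇒AllPairs (px ∷ pxs) = All.map (px ,_) pxs ∷ All⇒AllPairs pxs

module _ {n} {F : List (Pair n)} (P : MatchingInvolution F) where
  open MatchingInvolution P

  private
    Even : Vertex n → Set
    Even x = parity x ≡ false

    even? : ∀ x → Dec (Even x)
    even? x = parity x ≟ᴮ false

    -- Every matched edge has exactly one even endpoint, so it is listed once from that end.
    evenVertices : List (Vertex n)
    evenVertices = filter even? (allVertices n)

    edgeAt : Vertex n → Pair n
    edgeAt x = x , partner x

    partner-parity : ∀ x → parity (partner x) ≡ not (parity x)
    partner-parity x = Adj⇒parity-not x (partner x) (adjacent x)

    even≢partner-even : ∀ {x y} → Even x → Even y → x ≢ partner y
    even≢partner-even {x} {y} ex ey x≡py = not-¬ refl (begin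
      parity y            ≡⟨ ey ⟩
      false               ≡⟨ ex ⟨
      parity x            ≡⟨ cong parity x≡py ⟩
      parity (partner y)  ≡⟨ partner-parity y ⟩
      not (parity y)      ∎)
      where open ≡-Reasoning

    edgeAt-disjoint : ∀ {x y} → x ≢ y × (Even x × Even y) → Disjoint (edgeAt x) (edgeAt y)
    edgeAt-disjoint {x} {y} (x≢y , ex , ey) =
      x≢y ,
      even≢partner-even ex ey ,
      (λ px≡y → even≢partner-even ey ex (sym px≡y)) ,
      λ px≡py → x≢y (trans (sym (involutive x)) (trans (cong partner px≡py) (involutive y)))

    covers : ∀ x → Covered (map edgeAt evenVertices) x
    covers x with even? x
    ... | yes ex = Any.map⁺ (lose (∈-filter⁺ even? (∈-allVertices x) ex) (inj₁ refl))
    ... | no ¬ex = Any.map⁺ (lose (∈-filter⁺ even? (∈-allVertices (partner x)) epx) (inj₂ (sym (involutive x))))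
      where
      epx : Even (partner x)
      epx with parity x | partner-parity x
      ... | true  | eq = eq
      ... | false | _  = ⊥-elim (¬ex refl)

  involution⇒perfectMatching : HasPerfectMatching F
  involution⇒perfectMatching =
    map edgeAt evenVertices ,
    ( All.map⁺ (All.universal (λ x → adjacent x , fault-free x) evenVertices)
    , AllPairs.map⁺ (AllPairs.zipWith edgeAt-disjoint
        ( Unique.filter⁺ even? (allVertices-unique n)
        , All⇒AllPairs (All.all-filter even? (allVertices n)))))
    , covers

reflect : ∀ {m} → Vertex (suc m) → Vertex (suc m)
reflect (h ∷ t) = not h ∷ t

reflect-involutive : ∀ {m} (x : Vertex (suc m)) → reflect (reflect x) ≡ x
reflect-involutive (h ∷ t) = cong (_∷ t) (not-involutive h)

reflect-toggle : ∀ {m} i (x : Vertex (suc m)) → reflect (toggle i x) ≡ toggle i (reflect x)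
reflect-toggle zero    (h ∷ t) = refl
reflect-toggle (suc i) (h ∷ t) = refl

Adj-reflect : ∀ {m} (x y : Vertex (suc m)) → Adj x y → Adj (reflect x) (reflect y)
Adj-reflect (true ∷ x)  (true ∷ y)  xy = xy
Adj-reflect (true ∷ x)  (false ∷ y) xy = xy
Adj-reflect (false ∷ x) (true ∷ y)  xy = xy
Adj-reflect (false ∷ x) (false ∷ y) xy = xy

reflectEdge : ∀ {m} → Pair (suc m) → Pair (suc m)
reflectEdge (a , b) = reflect a , reflect b

reflectFaults : ∀ {m} → List (Pair (suc m)) → List (Pair (suc m))
reflectFaults = map reflectEdge

∈-reflectFaults⁻ : ∀ {m} {F : List (Pair (suc m))} {x y} → (x , y) ∈ reflectFaults F → (reflect x , reflect y) ∈ F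
∈-reflectFaults⁻ {F = F} xy∈ with (a , b) , ab∈F , refl ← ∈-map⁻ reflectEdge xy∈ =
  subst (_∈ F) (sym (cong₂ _,_ (reflect-involutive a) (reflect-involutive b))) ab∈F

Faulty-reflect⁺ : ∀ {m} {F : List (Pair (suc m))} {x y} → Faulty F x y → Faulty (reflectFaults F) (reflect x) (reflect y)
Faulty-reflect⁺ (inj₁ xy∈F) = inj₁ (∈-map⁺ reflectEdge xy∈F)
Faulty-reflect⁺ (inj₂ yx∈F) = inj₂ (∈-map⁺ reflectEdge yx∈F)

Faulty-reflect⁻ : ∀ {m} {F : List (Pair (suc m))} {x y} → Faulty (reflectFaults F) x y → Faulty F (reflect x) (reflect y)
Faulty-reflect⁻ (inj₁ xy∈) = inj₁ (∈-reflectFaults⁻ xy∈)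
Faulty-reflect⁻ (inj₂ yx∈) = inj₂ (∈-reflectFaults⁻ yx∈)

¬Faulty-reflect : ∀ {m} {F : List (Pair (suc m))} {x y} → ¬ Faulty F x y → ¬ Faulty (reflectFaults F) (reflect x) (reflect y)
¬Faulty-reflect {F = F} {x} {y} ¬xy fxy =
  ¬xy (subst₂ (Faulty F) (reflect-involutive x) (reflect-involutive y) (Faulty-reflect⁻ fxy))

reflectFaults-involutive : ∀ {m} (F : List (Pair (suc m))) → reflectFaults (reflectFaults F) ≡ F
reflectFaults-involutive []            = refl
reflectFaults-involutive ((a , b) ∷ F) =
  cong₂ _∷_ (cong₂ _,_ (reflect-involutive a) (reflect-involutive b)) (reflectFaults-involutive F)

length-reflectFaults : ∀ {m} (F : List (Pair (suc m))) → length (reflectFaults F) ≡ length F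
length-reflectFaults = length-map reflectEdge

NoIsolatedVertex-reflect : ∀ {m} {F : List (Pair (suc m))} → NoIsolatedVertex F → NoIsolatedVertex (reflectFaults F)
NoIsolatedVertex-reflect {F = F} noIso x with i , ¬fault ← noIso (reflect x) =
  i , λ fault → ¬fault (subst (Faulty F (reflect x)) (reflect-toggle i x) (Faulty-reflect⁻ fault))

module _ {m} {F : List (Pair (suc m))} (P : MatchingInvolution (reflectFaults F)) where
  open MatchingInvolution P

  unreflect : MatchingInvolution F
  unreflect = record
    { partner    = conjugate
    ; involutive = λ x → begin
        reflect (partner (reflect (reflect (partner (reflect x)))))
          ≡⟨ cong (reflect ∘ partner) (reflect-involutive (partner (reflect x))) ⟩
        reflect (partner (partner (reflect x)))  ≡⟨ cong reflect (involutive (reflect x)) ⟩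
        reflect (reflect x)                      ≡⟨ reflect-involutive x ⟩
        x                                        ∎
    ; adjacent   = λ x →
        subst (λ y → Adj y (conjugate x)) (reflect-involutive x)
              (Adj-reflect (reflect x) (partner (reflect x)) (adjacent (reflect x)))
    ; fault-free = λ x fault → fault-free (reflect x)
        (subst (Faulty (reflectFaults F) (reflect x)) (reflect-involutive (partner (reflect x)))
               (Faulty-reflect⁺ fault))
    }
    where
    open ≡-Reasoning
    conjugate : Vertex (suc m) → Vertex (suc m)
    conjugate x = reflect (partner (reflect x))

  unreflect-partner : ∀ a b → partner (reflect a) ≡ reflect b → MatchingInvolution.partner unreflect a ≡ b
  unreflect-partner a b pa≡b = trans (cong reflect pa≡b) (reflect-involutive b)

unreflectThrough : ∀ {m} {F : List (Pair (suc m))} {a b} →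
                   MatchingThrough (reflectFaults F) (reflect a) (reflect b) → MatchingThrough F a b
unreflectThrough {a = a} {b} (P , pa≡b) = unreflect P , unreflect-partner P a b pa≡b

lowerFaults : ∀ {m} → List (Pair (suc m)) → List (Pair m)
lowerFaults []                              = []
lowerFaults ((false ∷ a , false ∷ b) ∷ F)   = (a , b) ∷ lowerFaults F
lowerFaults ((false ∷ _ , true ∷ _) ∷ F)    = lowerFaults F
lowerFaults ((true ∷ _ , _) ∷ F)            = lowerFaults F

upperFaults : ∀ {m} → List (Pair (suc m)) → List (Pair m)
upperFaults F = lowerFaults (reflectFaults F)

crossFaults : ∀ {m} → List (Pair (suc m)) → List (Pair (suc m))
crossFaults []                             = []
crossFaults ((false ∷ a , false ∷ b) ∷ F)  = crossFaults F
crossFaults ((false ∷ a , true ∷ b) ∷ F)   = (false ∷ a , true ∷ b) ∷ crossFaults F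
crossFaults ((true ∷ a , false ∷ b) ∷ F)   = (true ∷ a , false ∷ b) ∷ crossFaults F
crossFaults ((true ∷ a , true ∷ b) ∷ F)    = crossFaults F

nonLowerFaults : ∀ {m} → List (Pair (suc m)) → List (Pair (suc m))
nonLowerFaults []                             = []
nonLowerFaults ((false ∷ a , false ∷ b) ∷ F)  = nonLowerFaults F
nonLowerFaults ((false ∷ a , true ∷ b) ∷ F)   = (false ∷ a , true ∷ b) ∷ nonLowerFaults F
nonLowerFaults ((true ∷ a , y) ∷ F)           = (true ∷ a , y) ∷ nonLowerFaults F

length-lower+nonLower : ∀ {m} (F : List (Pair (suc m))) →
                        length F ≡ length (lowerFaults F) + length (nonLowerFaults F)
length-lower+nonLower []                            = refl
length-lower+nonLower ((false ∷ a , false ∷ b) ∷ F) = cong suc (length-lower+nonLower F)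
length-lower+nonLower ((false ∷ a , true ∷ b) ∷ F)  =
  trans (cong suc (length-lower+nonLower F)) (sym (+-suc _ _))
length-lower+nonLower ((true ∷ a , y) ∷ F)          =
  trans (cong suc (length-lower+nonLower F)) (sym (+-suc _ _))

length-nonLowerFaults : ∀ {m} (F : List (Pair (suc m))) →
                        length (nonLowerFaults F) ≡ length (upperFaults F) + length (crossFaults F)
length-nonLowerFaults []                            = refl
length-nonLowerFaults ((false ∷ a , false ∷ b) ∷ F) = length-nonLowerFaults F
length-nonLowerFaults ((false ∷ a , true ∷ b) ∷ F)  =
  trans (cong suc (length-nonLowerFaults F)) (sym (+-suc _ _))
length-nonLowerFaults ((true ∷ a , false ∷ b) ∷ F)  =
  trans (cong suc (length-nonLowerFaults F)) (sym (+-suc _ _))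
length-nonLowerFaults ((true ∷ a , true ∷ b) ∷ F)   = cong suc (length-nonLowerFaults F)

length-split : ∀ {m} (F : List (Pair (suc m))) →
  length F ≡ length (lowerFaults F) + (length (upperFaults F) + length (crossFaults F))
length-split F = trans (length-lower+nonLower F) (cong (length (lowerFaults F) +_) (length-nonLowerFaults F))

length-crossFaults-reflect : ∀ {m} (F : List (Pair (suc m))) →
                             length (crossFaults (reflectFaults F)) ≡ length (crossFaults F)
length-crossFaults-reflect []                            = refl
length-crossFaults-reflect ((false ∷ a , false ∷ b) ∷ F) = length-crossFaults-reflect F
length-crossFaults-reflect ((false ∷ a , true ∷ b) ∷ F)  = cong suc (length-crossFaults-reflect F)
length-crossFaults-reflect ((true ∷ a , false ∷ b) ∷ F)  = cong suc (length-crossFaults-reflect F)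
length-crossFaults-reflect ((true ∷ a , true ∷ b) ∷ F)   = length-crossFaults-reflect F

∈-lowerFaults⁺ : ∀ {m} {F : List (Pair (suc m))} {a b} → (false ∷ a , false ∷ b) ∈ F → (a , b) ∈ lowerFaults F
∈-lowerFaults⁺ {F = _ ∷ _}                         (here refl) = here refl
∈-lowerFaults⁺ {F = (false ∷ _ , false ∷ _) ∷ _}   (there ab∈) = there (∈-lowerFaults⁺ ab∈)
∈-lowerFaults⁺ {F = (false ∷ _ , true ∷ _) ∷ _}    (there ab∈) = ∈-lowerFaults⁺ ab∈
∈-lowerFaults⁺ {F = (true ∷ _ , _) ∷ _}            (there ab∈) = ∈-lowerFaults⁺ ab∈

∈-lowerFaults⁻ : ∀ {m} {F : List (Pair (suc m))} {a b} → (a , b) ∈ lowerFaults F → (false ∷ a , false ∷ b) ∈ F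
∈-lowerFaults⁻ {F = (false ∷ _ , false ∷ _) ∷ _} (here refl) = here refl
∈-lowerFaults⁻ {F = (false ∷ _ , false ∷ _) ∷ _} (there ab∈) = there (∈-lowerFaults⁻ ab∈)
∈-lowerFaults⁻ {F = (false ∷ _ , true ∷ _) ∷ _}  ab∈         = there (∈-lowerFaults⁻ ab∈)
∈-lowerFaults⁻ {F = (true ∷ _ , _) ∷ _}          ab∈         = there (∈-lowerFaults⁻ ab∈)

∈-nonLowerFaults⁺ˡ : ∀ {m} {F : List (Pair (suc m))} {a y} → (true ∷ a , y) ∈ F → (true ∷ a , y) ∈ nonLowerFaults F
∈-nonLowerFaults⁺ˡ {F = _ ∷ _}                       (here refl) = here refl
∈-nonLowerFaults⁺ˡ {F = (false ∷ _ , false ∷ _) ∷ _} (there e∈)  = ∈-nonLowerFaults⁺ˡ e∈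
∈-nonLowerFaults⁺ˡ {F = (false ∷ _ , true ∷ _) ∷ _}  (there e∈)  = there (∈-nonLowerFaults⁺ˡ e∈)
∈-nonLowerFaults⁺ˡ {F = (true ∷ _ , _) ∷ _}          (there e∈)  = there (∈-nonLowerFaults⁺ˡ e∈)

∈-nonLowerFaults⁺ʳ : ∀ {m} {F : List (Pair (suc m))} {x b} → (x , true ∷ b) ∈ F → (x , true ∷ b) ∈ nonLowerFaults F
∈-nonLowerFaults⁺ʳ {F = (false ∷ _ , true ∷ _) ∷ _}  (here refl) = here refl
∈-nonLowerFaults⁺ʳ {F = (true ∷ _ , _) ∷ _}          (here refl) = here refl
∈-nonLowerFaults⁺ʳ {F = (false ∷ _ , false ∷ _) ∷ _} (there e∈)  = ∈-nonLowerFaults⁺ʳ e∈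
∈-nonLowerFaults⁺ʳ {F = (false ∷ _ , true ∷ _) ∷ _}  (there e∈)  = there (∈-nonLowerFaults⁺ʳ e∈)
∈-nonLowerFaults⁺ʳ {F = (true ∷ _ , _) ∷ _}          (there e∈)  = there (∈-nonLowerFaults⁺ʳ e∈)

∈-crossFaults⁺ : ∀ {m} {F : List (Pair (suc m))} {h a b} → (h ∷ a , not h ∷ b) ∈ F → (h ∷ a , not h ∷ b) ∈ crossFaults F
∈-crossFaults⁺ {F = (false ∷ _ , true ∷ _) ∷ _}  {false} (here refl) = here refl
∈-crossFaults⁺ {F = (true ∷ _ , false ∷ _) ∷ _}  {true}  (here refl) = here refl
∈-crossFaults⁺ {F = (false ∷ _ , false ∷ _) ∷ _}         (there e∈)  = ∈-crossFaults⁺ e∈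
∈-crossFaults⁺ {F = (false ∷ _ , true ∷ _) ∷ _}          (there e∈)  = there (∈-crossFaults⁺ e∈)
∈-crossFaults⁺ {F = (true ∷ _ , false ∷ _) ∷ _}          (there e∈)  = there (∈-crossFaults⁺ e∈)
∈-crossFaults⁺ {F = (true ∷ _ , true ∷ _) ∷ _}           (there e∈)  = ∈-crossFaults⁺ e∈

Faulty-lowerFaults⁺ : ∀ {m} {F : List (Pair (suc m))} {a b} → Faulty F (false ∷ a) (false ∷ b) → Faulty (lowerFaults F) a b
Faulty-lowerFaults⁺ (inj₁ ab∈) = inj₁ (∈-lowerFaults⁺ ab∈)
Faulty-lowerFaults⁺ (inj₂ ba∈) = inj₂ (∈-lowerFaults⁺ ba∈)

Faulty-lowerFaults⁻ : ∀ {m} {F : List (Pair (suc m))} {a b} → Faulty (lowerFaults F) a b → Faulty F (false ∷ a) (false ∷ b)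
Faulty-lowerFaults⁻ (inj₁ ab∈) = inj₁ (∈-lowerFaults⁻ ab∈)
Faulty-lowerFaults⁻ (inj₂ ba∈) = inj₂ (∈-lowerFaults⁻ ba∈)

Faulty-upperFaults⁺ : ∀ {m} {F : List (Pair (suc m))} {a b} → Faulty F (true ∷ a) (true ∷ b) → Faulty (upperFaults F) a b
Faulty-upperFaults⁺ fault = Faulty-lowerFaults⁺ (Faulty-reflect⁺ fault)

Faulty-upperFaults⁻ : ∀ {m} {F : List (Pair (suc m))} {a b} → Faulty (upperFaults F) a b → Faulty F (true ∷ a) (true ∷ b)
Faulty-upperFaults⁻ fault = Faulty-reflect⁻ (Faulty-lowerFaults⁻ fault)

Faulty-nonLowerFaults⁺ : ∀ {m} {F : List (Pair (suc m))} {a y} → Faulty F (true ∷ a) y → Faulty (nonLowerFaults F) (true ∷ a) y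
Faulty-nonLowerFaults⁺ (inj₁ e∈) = inj₁ (∈-nonLowerFaults⁺ˡ e∈)
Faulty-nonLowerFaults⁺ (inj₂ e∈) = inj₂ (∈-nonLowerFaults⁺ʳ e∈)

∈⇒length≢0 : ∀ {A : Set} {x : A} {xs} → x ∈ xs → length xs ≢ 0
∈⇒length≢0 {xs = _ ∷ _} _ ()

0<length⇒∃∈ : ∀ {A : Set} {xs : List A} → 0 < length xs → ∃ (_∈ xs)
0<length⇒∃∈ {xs = x ∷ _} _ = x , here refl

length≡1⇒singleton : ∀ {A : Set} (xs : List A) → length xs ≡ 1 → ∃ λ x → xs ≡ x ∷ []
length≡1⇒singleton (x ∷ []) _ = x , refl

noCrossFaults : ∀ {m} {F : List (Pair (suc m))} → length (crossFaults F) ≡ 0 → ∀ t → ¬ Faulty F (false ∷ t) (true ∷ t)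
noCrossFaults {F = F} none t (inj₁ e∈) = ∈⇒length≢0 (∈-crossFaults⁺ {F = F} {h = false} e∈) none
noCrossFaults {F = F} none t (inj₂ e∈) = ∈⇒length≢0 (∈-crossFaults⁺ {F = F} {h = true} e∈) none

sameEdge? : ∀ {n} (e f : Pair n) → Dec (SameEdge e f)
sameEdge? (a , b) (c , d) = ((a ≟ⱽ c) ×-dec (b ≟ⱽ d)) ⊎-dec ((a ≟ⱽ d) ×-dec (b ≟ⱽ c))

SameEdge-swapˡ : ∀ {n} {x y : Vertex n} {e} → SameEdge (x , y) e → SameEdge (y , x) e
SameEdge-swapˡ (inj₁ (x≡a , y≡b)) = inj₂ (y≡b , x≡a)
SameEdge-swapˡ (inj₂ (x≡b , y≡a)) = inj₁ (y≡a , x≡b)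

Faulty⇒∃SameEdge : ∀ {n} {F : List (Pair n)} {x y} → Faulty F x y → ∃ λ e → e ∈ F × SameEdge e (x , y)
Faulty⇒∃SameEdge (inj₁ xy∈F) = _ , xy∈F , inj₁ (refl , refl)
Faulty⇒∃SameEdge (inj₂ yx∈F) = _ , yx∈F , inj₂ (refl , refl)

removeEdge : ∀ {n} → Pair n → List (Pair n) → List (Pair n)
removeEdge e = filter (λ f → ¬? (sameEdge? f e))

Faulty-removeEdge⁻ : ∀ {n} {F : List (Pair n)} {e x y} → Faulty (removeEdge e F) x y → Faulty F x y
Faulty-removeEdge⁻ {F = F} {e} (inj₁ xy∈) = inj₁ (proj₁ (∈-filter⁻ (λ f → ¬? (sameEdge? f e)) {xs = F} xy∈))
Faulty-removeEdge⁻ {F = F} {e} (inj₂ yx∈) = inj₂ (proj₁ (∈-filter⁻ (λ f → ¬? (sameEdge? f e)) {xs = F} yx∈))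

Faulty-removeEdge : ∀ {n} {F : List (Pair n)} {e x y} → Faulty F x y → Faulty (removeEdge e F) x y ⊎ SameEdge (x , y) e
Faulty-removeEdge {e = e} {x} {y} (inj₁ xy∈F) with sameEdge? (x , y) e
... | yes same = inj₂ same
... | no ¬same = inj₁ (inj₁ (∈-filter⁺ (λ f → ¬? (sameEdge? f e)) xy∈F ¬same))
Faulty-removeEdge {e = e} {x} {y} (inj₂ yx∈F) with sameEdge? (y , x) e
... | yes same = inj₂ (SameEdge-swapˡ same)
... | no ¬same = inj₁ (inj₂ (∈-filter⁺ (λ f → ¬? (sameEdge? f e)) yx∈F ¬same))

removeEdge-removes : ∀ {n} {F : List (Pair n)} {a b} → ¬ Faulty (removeEdge (a , b) F) a b
removeEdge-removes {F = F} {a} {b} (inj₁ ab∈) =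
  proj₂ (∈-filter⁻ (λ f → ¬? (sameEdge? f (a , b))) {xs = F} ab∈) (inj₁ (refl , refl))
removeEdge-removes {F = F} {a} {b} (inj₂ ba∈) =
  proj₂ (∈-filter⁻ (λ f → ¬? (sameEdge? f (a , b))) {xs = F} ba∈) (inj₂ (refl , refl))

length-removeEdge : ∀ {n} {F : List (Pair n)} {a b} → Faulty F a b → length (removeEdge (a , b) F) < length F
length-removeEdge {F = F} {a} {b} fault with e , e∈F , same ← Faulty⇒∃SameEdge fault =
  filter-notAll (λ f → ¬? (sameEdge? f (a , b))) F (lose e∈F (λ ¬same → ¬same same))

toggleMatching : ∀ {n} {F : List (Pair n)} i → (∀ t → ¬ Faulty F t (toggle i t)) → MatchingInvolution F
toggleMatching i fault-free = record
  { partner = toggle i ; involutive = toggle-involutive i ; adjacent = Adj-toggle i ; fault-free = fault-free }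

restoreEdge : ∀ {n} {F : List (Pair n)} {a b} (P : MatchingInvolution (removeEdge (a , b) F)) →
              MatchingInvolution.partner P a ≢ b → MatchingInvolution F
restoreEdge {F = F} {a} {b} P pa≢b = record
  { partner = partner ; involutive = involutive ; adjacent = adjacent ; fault-free = fault-free′ }
  where
  open MatchingInvolution P
  fault-free′ : ∀ t → ¬ Faulty F t (partner t)
  fault-free′ t fault with Faulty-removeEdge {e = a , b} fault
  ... | inj₁ fault′                = fault-free t fault′
  ... | inj₂ (inj₁ (refl , pa≡b))  = pa≢b pa≡b
  ... | inj₂ (inj₂ (refl , pb≡a))  = pa≢b (trans (cong partner (sym pb≡a)) (involutive t))

module Glue {m} (F : List (Pair (suc m))) {W : Vertex m → Set} (W? : ∀ t → Dec (W t))
  (q : Bool → Vertex m → Vertex m)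
  (q-involutive : ∀ h t → W t → q h (q h t) ≡ t)
  (q-stays      : ∀ h t → W t → W (q h t))
  (q-adjacent   : ∀ h t → W t → Adj t (q h t))
  (q-fault-free : ∀ h t → W t → ¬ Faulty F (h ∷ t) (h ∷ q h t))
  (across-fault-free : ∀ t → ¬ W t → ¬ Faulty F (false ∷ t) (true ∷ t)) where

  private
    glued : Vertex (suc m) → Vertex (suc m)
    glued (h ∷ t) with W? t
    ... | yes _ = h ∷ q h t
    ... | no  _ = not h ∷ t

  glued-within : ∀ h t → W t → glued (h ∷ t) ≡ h ∷ q h t
  glued-within h t w with W? t
  ... | yes _ = refl
  ... | no ¬w = ⊥-elim (¬w w)

  glued-across : ∀ h t → ¬ W t → glued (h ∷ t) ≡ not h ∷ t
  glued-across h t ¬w with W? t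
  ... | yes w = ⊥-elim (¬w w)
  ... | no  _ = refl

  private
    across-fault-free′ : ∀ h t → ¬ W t → ¬ Faulty F (h ∷ t) (not h ∷ t)
    across-fault-free′ false t ¬w       = across-fault-free t ¬w
    across-fault-free′ true  t ¬w fault = across-fault-free t ¬w (Faulty-sym F fault)

    glued-involutive : ∀ x → glued (glued x) ≡ x
    glued-involutive (h ∷ t) with W? t
    ... | yes w = trans (glued-within h (q h t) (q-stays h t w)) (cong (h ∷_) (q-involutive h t w))
    ... | no ¬w = trans (glued-across (not h) t ¬w) (cong (_∷ t) (not-involutive h))

    glued-adjacent : ∀ x → Adj x (glued x)
    glued-adjacent (h ∷ t) with W? t
    ... | yes w = Adj-∷ h (q-adjacent h t w)
    ... | no  _ = Adj-not∷ h t

    glued-fault-free : ∀ x → ¬ Faulty F x (glued x)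
    glued-fault-free (h ∷ t) with W? t
    ... | yes w = q-fault-free h t w
    ... | no ¬w = across-fault-free′ h t ¬w

  glue : MatchingInvolution F
  glue = record
    { partner = glued ; involutive = glued-involutive ; adjacent = glued-adjacent ; fault-free = glued-fault-free }

module Halves {m} {F₀ F₁ : List (Pair m)} (P₀ : MatchingInvolution F₀) (P₁ : MatchingInvolution F₁) where
  open MatchingInvolution

  q : Bool → Vertex m → Vertex m
  q false = partner P₀
  q true  = partner P₁

  q-involutive : ∀ h t → q h (q h t) ≡ t
  q-involutive false = involutive P₀
  q-involutive true  = involutive P₁

  q-adjacent : ∀ h t → Adj t (q h t)
  q-adjacent false = adjacent P₀
  q-adjacent true  = adjacent P₁

  q-stays : ∀ {a b t} → q false a ≡ b → q true a ≡ b → ∀ h → t ≢ a → t ≢ b → q h t ≢ a × q h t ≢ b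
  q-stays {a} {b} {t} q₀a≡b q₁a≡b h t≢a t≢b =
    (λ qt≡a → t≢b (trans (sym (q-involutive h t)) (trans (cong (q h) qt≡a) (qa≡b h)))) ,
    (λ qt≡b → t≢a (trans (sym (q-involutive h t)) (trans (cong (q h) qt≡b)
                    (trans (cong (q h) (sym (qa≡b h))) (q-involutive h a)))))
    where
    qa≡b : ∀ h → q h a ≡ b
    qa≡b false = q₀a≡b
    qa≡b true  = q₁a≡b

module _ {m} (F : List (Pair (suc m))) where

  matchAcross : length (crossFaults F) ≡ 0 → MatchingInvolution F
  matchAcross none = Glue.glue F {W = λ _ → ⊥} (λ _ → no λ ()) (λ _ t → t)
    (λ _ _ ()) (λ _ _ ()) (λ _ _ ()) (λ _ _ ()) (λ t _ → noCrossFaults none t)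

  combine : MatchingInvolution (lowerFaults F) → MatchingInvolution (upperFaults F) → MatchingInvolution F
  combine P₀ P₁ = Glue.glue F {W = λ _ → ⊤} (λ _ → yes tt) q
    (λ h t _ → q-involutive h t) (λ _ _ _ → tt) (λ h t _ → q-adjacent h t) q-fault-free (λ _ ¬w → ⊥-elim (¬w tt))
    where
    open Halves P₀ P₁
    q-fault-free : ∀ h t → ⊤ → ¬ Faulty F (h ∷ t) (h ∷ q h t)
    q-fault-free false t _ fault = MatchingInvolution.fault-free P₀ t (Faulty-lowerFaults⁺ fault)
    q-fault-free true  t _ fault = MatchingInvolution.fault-free P₁ t (Faulty-upperFaults⁺ fault)

  reroute : ∀ {a b} → ¬ Faulty F (false ∷ a) (true ∷ a) → ¬ Faulty F (false ∷ b) (true ∷ b) →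
            MatchingThrough (removeEdge (a , b) (lowerFaults F)) a b → MatchingThrough (upperFaults F) a b →
            MatchingThrough F (false ∷ a) (true ∷ a)
  reroute {a} {b} ¬fa ¬fb (P₀ , p₀a≡b) (P₁ , p₁a≡b) = G.glue , G.glued-across false a (λ (a≢a , _) → a≢a refl)
    where
    open Halves P₀ P₁
    Inner : Vertex m → Set
    Inner t = t ≢ a × t ≢ b
    inner? : ∀ t → Dec (Inner t)
    inner? t = ¬? (t ≟ⱽ a) ×-dec ¬? (t ≟ⱽ b)
    q-involutive′ : ∀ h t → Inner t → q h (q h t) ≡ t
    q-involutive′ h t _ = q-involutive h t
    q-adjacent′ : ∀ h t → Inner t → Adj t (q h t)
    q-adjacent′ h t _ = q-adjacent h t
    q-stays′ : ∀ h t → Inner t → Inner (q h t)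
    q-stays′ h t (t≢a , t≢b) = q-stays p₀a≡b p₁a≡b h t≢a t≢b
    q-fault-free : ∀ h t → Inner t → ¬ Faulty F (h ∷ t) (h ∷ q h t)
    q-fault-free false t (t≢a , t≢b) fault with Faulty-removeEdge {e = a , b} (Faulty-lowerFaults⁺ fault)
    ... | inj₁ fault′           = MatchingInvolution.fault-free P₀ t fault′
    ... | inj₂ (inj₁ (t≡a , _)) = t≢a t≡a
    ... | inj₂ (inj₂ (t≡b , _)) = t≢b t≡b
    q-fault-free true  t _ fault = MatchingInvolution.fault-free P₁ t (Faulty-upperFaults⁺ fault)
    across : ∀ t → ¬ Inner t → ¬ Faulty F (false ∷ t) (true ∷ t)
    across t ¬inner with t ≟ⱽ a | t ≟ⱽ b
    ... | yes refl | _        = ¬fa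
    ... | no  _    | yes refl = ¬fb
    ... | no  t≢a  | no  t≢b  = ⊥-elim (¬inner (t≢a , t≢b))
    module G = Glue F inner? q q-involutive′ q-stays′ q-adjacent′ q-fault-free across

  square : ∀ {a b} → Adj a b → ¬ Faulty F (false ∷ a) (false ∷ b) →
           length (upperFaults F) ≡ 0 → length (crossFaults F) ≡ 0 → MatchingThrough F (false ∷ a) (false ∷ b)
  square {a} {b} ab ¬fab noUpper noCross =
    G.glue , trans (G.glued-within false a (inj₁ refl)) (cong (false ∷_) swap-a)
    where
    Endpoint : Vertex m → Set
    Endpoint t = t ≡ a ⊎ t ≡ b
    endpoint? : ∀ t → Dec (Endpoint t)
    endpoint? t = (t ≟ⱽ a) ⊎-dec (t ≟ⱽ b)
    swap : Bool → Vertex m → Vertex m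
    swap _ t with t ≟ⱽ a
    ... | yes _ = b
    ... | no  _ = a
    swap-a : ∀ {h} → swap h a ≡ b
    swap-a with a ≟ⱽ a
    ... | yes _   = refl
    ... | no  a≢a = ⊥-elim (a≢a refl)
    swap-b : ∀ {h} → swap h b ≡ a
    swap-b with b ≟ⱽ a
    ... | yes b≡a = ⊥-elim (Adj⇒≢ ab (sym b≡a))
    ... | no  _   = refl
    swap-involutive : ∀ h t → Endpoint t → swap h (swap h t) ≡ t
    swap-involutive h _ (inj₁ refl) = trans (cong (swap h) swap-a) swap-b
    swap-involutive h _ (inj₂ refl) = trans (cong (swap h) swap-b) swap-a
    swap-stays : ∀ h t → Endpoint t → Endpoint (swap h t)
    swap-stays h _ (inj₁ refl) = inj₂ swap-a
    swap-stays h _ (inj₂ refl) = inj₁ swap-b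
    swap-adjacent : ∀ h t → Endpoint t → Adj t (swap h t)
    swap-adjacent h _ (inj₁ refl) = subst (Adj a) (sym swap-a) ab
    swap-adjacent h _ (inj₂ refl) = subst (Adj b) (sym swap-b) (Adj-sym {x = a} {b} ab)
    swap-fault-free : ∀ h t → Endpoint t → ¬ Faulty F (h ∷ t) (h ∷ swap h t)
    swap-fault-free true  t _ fault with Faulty-upperFaults⁺ fault
    ... | inj₁ e∈ = ∈⇒length≢0 e∈ noUpper
    ... | inj₂ e∈ = ∈⇒length≢0 e∈ noUpper
    swap-fault-free false _ (inj₁ refl) = subst (λ z → ¬ Faulty F (false ∷ a) (false ∷ z)) (sym swap-a) ¬fab
    swap-fault-free false _ (inj₂ refl) = subst (λ z → ¬ Faulty F (false ∷ b) (false ∷ z)) (sym swap-b) (¬fab ∘ Faulty-sym F)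
    across : ∀ t → ¬ Endpoint t → ¬ Faulty F (false ∷ t) (true ∷ t)
    across t _ = noCrossFaults noCross t
    module G = Glue F endpoint? swap swap-involutive swap-stays swap-adjacent swap-fault-free across

withFewerFaults : ∀ {n} {F F′ : List (Pair n)} → (∀ {x y} → Faulty F′ x y → Faulty F x y) →
                  MatchingInvolution F → MatchingInvolution F′
withFewerFaults F′⊆F P = record
  { partner = partner ; involutive = involutive ; adjacent = adjacent ; fault-free = λ x → fault-free x ∘ F′⊆F }
  where open MatchingInvolution P

pigeonhole : {A B : Set} (Hits : A → B → Set) → (∀ f b → Dec (Hits f b)) →
             (L : List B) → Unique L → (Fs : List A) →
             (∀ f {b c} → b ∈ L → c ∈ L → Hits f b → Hits f c → b ≡ c) →
             length Fs < length L → ∃ λ b → b ∈ L × (∀ f → f ∈ Fs → ¬ Hits f b)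
pigeonhole Hits hits? (y ∷ L) (y∉L ∷ L!) Fs hitsOne |Fs|<|L| with any? (λ f → hits? f y) Fs
... | no ¬hit = y , here refl , λ f f∈Fs hit → ¬hit (lose f∈Fs hit)
... | yes hit = b , there b∈L , unhit
  where
  missY = λ f → ¬? (hits? f y)
  -- The hitters of y are discarded; they cannot hit anything else of L.
  rest : ∃ λ b → b ∈ L × (∀ f → f ∈ filter missY Fs → ¬ Hits f b)
  rest = pigeonhole Hits hits? L L! (filter missY Fs)
    (λ f b∈ c∈ → hitsOne f (there b∈) (there c∈))
    (<-≤-trans (filter-notAll missY Fs (Any.map (λ h ¬h → ¬h h) hit)) (≤-pred |Fs|<|L|))
  b = proj₁ rest
  b∈L = proj₁ (proj₂ rest)
  unhit : ∀ f → f ∈ Fs → ¬ Hits f b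
  unhit f f∈Fs hitB with hits? f y
  ... | yes hitY = All.lookup y∉L b∈L (hitsOne f (here refl) (there b∈L) hitY hitB)
  ... | no ¬hitY = proj₂ (proj₂ rest) f (∈-filter⁺ missY f∈Fs ¬hitY) hitB

<-summands : ∀ a b {c n} → a + (b + c) < n → 0 < c → suc a < n × suc b < n
<-summands a b {c} sum<n 0<c =
  ≤-<-trans (m<m+n a (<-≤-trans 0<c (m≤n+m c b))) sum<n ,
  ≤-<-trans (≤-trans (m<m+n b 0<c) (m≤n+m (b + c) a)) sum<n

fewFaults⇒matching : ∀ n (F : List (Pair n)) → length F < n → MatchingInvolution F
fewFaults⇒matching zero    F ()
fewFaults⇒matching (suc n) F |F|<n with length (crossFaults F) ≟ 0
... | yes none = matchAcross F none
... | no  some = combine F (fewFaults⇒matching n (lowerFaults F) (≤-pred lower<))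
                           (fewFaults⇒matching n (upperFaults F) (≤-pred upper<))
  where
  halves = <-summands (length (lowerFaults F)) (length (upperFaults F))
             (subst (_< suc n) (length-split F) |F|<n) (n≢0⇒n>0 some)
  lower< = proj₁ halves
  upper< = proj₂ halves

module _ {j} (t : Vertex j) where

  private
    Blocks : Pair (suc j) → Fin j → Set
    Blocks f i = SameEdge f (false ∷ t , false ∷ toggle i t)
               ⊎ SameEdge f (true ∷ t , true ∷ toggle i t)
               ⊎ SameEdge f (false ∷ toggle i t , true ∷ toggle i t)

    blocks? : ∀ f i → Dec (Blocks f i)
    blocks? f i = sameEdge? f _ ⊎-dec sameEdge? f _ ⊎-dec sameEdge? f _

    farEnd : Pair (suc j) → Vertex j
    farEnd (x , y) with tail x ≟ⱽ t
    ... | yes _ = tail y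
    ... | no  _ = tail x

    farEnd-from-t : ∀ h₁ h₂ c → farEnd (h₁ ∷ t , h₂ ∷ c) ≡ c
    farEnd-from-t h₁ h₂ c with t ≟ⱽ t
    ... | yes _   = refl
    ... | no  t≢t = ⊥-elim (t≢t refl)

    farEnd-from-c : ∀ {c} → c ≢ t → ∀ h₁ y → farEnd (h₁ ∷ c , y) ≡ c
    farEnd-from-c {c} c≢t h₁ y with c ≟ⱽ t
    ... | yes c≡t = ⊥-elim (c≢t c≡t)
    ... | no  _   = refl

    farEnd-blocks : ∀ f i → Blocks f i → farEnd f ≡ toggle i t
    farEnd-blocks _ i (inj₁ (inj₁ (refl , refl)))        = farEnd-from-t false false (toggle i t)
    farEnd-blocks _ i (inj₁ (inj₂ (refl , refl)))        = farEnd-from-c (toggle-≢ i t) false _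
    farEnd-blocks _ i (inj₂ (inj₁ (inj₁ (refl , refl)))) = farEnd-from-t true true (toggle i t)
    farEnd-blocks _ i (inj₂ (inj₁ (inj₂ (refl , refl)))) = farEnd-from-c (toggle-≢ i t) true _
    farEnd-blocks _ i (inj₂ (inj₂ (inj₁ (refl , refl)))) = farEnd-from-c (toggle-≢ i t) false _
    farEnd-blocks _ i (inj₂ (inj₂ (inj₂ (refl , refl)))) = farEnd-from-c (toggle-≢ i t) true _

    blocksOne : ∀ f {i i′} → i ∈ allFin j → i′ ∈ allFin j → Blocks f i → Blocks f i′ → i ≡ i′
    blocksOne f {i} {i′} _ _ bi bi′ =
      toggle-injective i i′ t (trans (sym (farEnd-blocks f i bi)) (farEnd-blocks f i′ bi′))

  freeSquare : (F : List (Pair (suc j))) → length F < j →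
    ∃ λ i → ¬ Faulty F (false ∷ t) (false ∷ toggle i t)
          × ¬ Faulty F (true ∷ t) (true ∷ toggle i t)
          × ¬ Faulty F (false ∷ toggle i t) (true ∷ toggle i t)
  freeSquare F |F|<j
    with i , _ , unblocked ← pigeonhole Blocks blocks? (allFin j) (Unique.allFin⁺ j) F blocksOne
                               (subst (length F <_) (sym (length-tabulate {n = j} (λ i → i))) |F|<j) =
    i , (λ fault → let e , e∈F , same = Faulty⇒∃SameEdge fault in unblocked e e∈F (inj₁ same))
      , (λ fault → let e , e∈F , same = Faulty⇒∃SameEdge fault in unblocked e e∈F (inj₂ (inj₁ same)))
      , (λ fault → let e , e∈F , same = Faulty⇒∃SameEdge fault in unblocked e e∈F (inj₂ (inj₂ same)))

ThroughAnyEdge : ℕ → Set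
ThroughAnyEdge k = ∀ (F : List (Pair k)) a b → suc (suc (length F)) ≤ k → Adj a b → ¬ Faulty F a b →
                   MatchingThrough F a b

+-squeeze : ∀ a x {j} → a + x < j → j ≤ suc a → x ≡ 0
+-squeeze a x a+x<j j≤1+a =
  n≤0⇒n≡0 (+-cancelˡ-≤ a x 0 (subst (a + x ≤_) (sym (+-identityʳ a)) (≤-pred (<-≤-trans a+x<j j≤1+a))))

middle≤sum : ∀ a b c → b ≤ a + (b + c)
middle≤sum a b c = ≤-trans (m≤m+n b c) (m≤n+m (b + c) a)

module _ {j} (throughAnyEdge : ThroughAnyEdge j) (F : List (Pair (suc j))) (2+|F|≤1+j : suc (suc (length F)) ≤ suc j) where
  private
    A = length (lowerFaults F)
    B = length (upperFaults F)
    C = length (crossFaults F)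
    split<j : A + (B + C) < j
    split<j = subst (_< j) (length-split F) (≤-pred 2+|F|≤1+j)

  throughLowerEdge : ∀ {a b} → Adj a b → ¬ Faulty F (false ∷ a) (false ∷ b) → MatchingThrough F (false ∷ a) (false ∷ b)
  throughLowerEdge {a} {b} ab ¬fab with suc (suc A) ≤? j
  ... | yes 2+A≤j =
    let P₀ , p₀a≡b = throughAnyEdge (lowerFaults F) a b 2+A≤j ab (¬fab ∘ Faulty-lowerFaults⁻) in
    combine F P₀ (fewFaults⇒matching j (upperFaults F) (≤-<-trans (middle≤sum A B C) split<j)) ,
    cong (false ∷_) p₀a≡b
  ... | no 2+A≰j = square F ab ¬fab (m+n≡0⇒m≡0 B B+C≡0) (m+n≡0⇒n≡0 B B+C≡0)
    where
    B+C≡0 : B + C ≡ 0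
    B+C≡0 = +-squeeze A (B + C) split<j (≤-pred (≰⇒> 2+A≰j))

  throughCrossEdge : ∀ {t} → ¬ Faulty F (false ∷ t) (true ∷ t) → MatchingThrough F (false ∷ t) (true ∷ t)
  throughCrossEdge {t} ¬ft with C ≟ 0
  ... | yes none = matchAcross F none , refl
  ... | no  some
    with i , ¬f₀ , ¬f₁ , ¬fc ← freeSquare t F (<-≤-trans (n<1+n (length F)) (≤-pred 2+|F|≤1+j)) =
    reroute F ¬ft ¬fc (withFewerFaults Faulty-removeEdge⁻ P₀ , p₀t≡ti) (throughAnyEdge (upperFaults F) t (toggle i t)
      (proj₂ halves) (Adj-toggle i t) (¬f₁ ∘ Faulty-upperFaults⁻))
    where
    halves = <-summands A B split<j (n≢0⇒n>0 some)
    lower = throughAnyEdge (lowerFaults F) t (toggle i t) (proj₁ halves) (Adj-toggle i t) (¬f₀ ∘ Faulty-lowerFaults⁻)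
    P₀ = proj₁ lower
    p₀t≡ti = proj₂ lower

fewFaults⇒matchingThrough : ∀ k → ThroughAnyEdge k
fewFaults⇒matchingThrough zero    F a b ()
fewFaults⇒matchingThrough (suc j) F (false ∷ a) (false ∷ b) 2+|F|≤k ab ¬fab =
  throughLowerEdge (fewFaults⇒matchingThrough j) F 2+|F|≤k ab ¬fab
fewFaults⇒matchingThrough (suc j) F (true ∷ a)  (true ∷ b)  2+|F|≤k ab ¬fab =
  unreflectThrough (throughLowerEdge (fewFaults⇒matchingThrough j) (reflectFaults F)
    (subst (λ l → suc (suc l) ≤ suc j) (sym (length-reflectFaults F)) 2+|F|≤k) ab (¬Faulty-reflect ¬fab))
fewFaults⇒matchingThrough (suc j) F (false ∷ a) (true ∷ b)  2+|F|≤k ab ¬fab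
  with refl ← hamming≡0⇒≡ a b (suc-injective ab) =
  throughCrossEdge (fewFaults⇒matchingThrough j) F 2+|F|≤k ¬fab
fewFaults⇒matchingThrough (suc j) F (true ∷ a)  (false ∷ b) 2+|F|≤k ab ¬fab
  with refl ← hamming≡0⇒≡ a b (suc-injective ab) =
  unreflectThrough (throughCrossEdge (fewFaults⇒matchingThrough j) (reflectFaults F)
    (subst (λ l → suc (suc l) ≤ suc j) (sym (length-reflectFaults F)) 2+|F|≤k) (¬Faulty-reflect ¬fab))

length≤1+filter : ∀ {A : Set} {P : A → Set} (P? : ∀ x → Dec (P x)) (xs : List A) → Unique xs →
                  (∀ {a b} → a ∈ xs → b ∈ xs → ¬ P a → ¬ P b → a ≡ b) → length xs ≤ suc (length (filter P? xs))
length≤1+filter P? []       _           _         = z≤n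
length≤1+filter {P = P} P? (x ∷ xs) (x∉xs ∷ xs!) failsOnce with P? x
... | yes _  = s≤s (length≤1+filter P? xs xs! (λ a∈ b∈ → failsOnce (there a∈) (there b∈)))
... | no ¬px = s≤s (≤-reflexive (sym (cong length (filter-all P? (rest xs x∉xs (λ b∈ → failsOnce (here refl) (there b∈)))))))
  where
  rest : ∀ ys → All (x ≢_) ys → (∀ {b} → b ∈ ys → ¬ P x → ¬ P b → x ≡ b) → All P ys
  rest []       _             _      = []
  rest (y ∷ ys) (x≢y ∷ x∉ys) onlyX with P? y
  ... | yes py  = py ∷ rest ys x∉ys (onlyX ∘ there)
  ... | no ¬py  = ⊥-elim (x≢y (onlyX (here refl) ¬px ¬py))

Isolated : ∀ {n} → List (Pair n) → Vertex n → Set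
Isolated F x = ∀ i → Faulty F x (toggle i x)

module _ {M} {x y : Vertex M} (x≢y : x ≢ y) where
  private
    notToX? : ∀ i → Dec (toggle i y ≢ x)
    notToX? i = ¬? (toggle i y ≟ⱽ x)

    edgesAtX edgesAtY edgesAtXY : List (Pair M)
    edgesAtX  = map (λ i → x , toggle i x) (allFin M)
    edgesAtY  = map (λ i → y , toggle i y) (filter notToX? (allFin M))
    edgesAtXY = edgesAtX ++ edgesAtY

    Listed : Pair M → Set
    Listed (a , b) = (a ≡ x ⊎ (a ≡ y × b ≢ x)) × a ≢ b

    listed : ∀ {e} → e ∈ edgesAtXY → Listed e
    listed e∈ with ∈-++⁻ edgesAtX e∈
    ... | inj₁ e∈X with i , _ , refl ← ∈-map⁻ (λ i → x , toggle i x) e∈X =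
      inj₁ refl , λ x≡ → toggle-≢ i x (sym x≡)
    ... | inj₂ e∈Y with i , i∈ , refl ← ∈-map⁻ (λ i → y , toggle i y) e∈Y =
      inj₂ (refl , proj₂ (∈-filter⁻ notToX? {xs = allFin M} i∈)) , λ y≡ → toggle-≢ i y (sym y≡)

    listedOnce : ∀ {a b} → (a , b) ∈ edgesAtXY → (b , a) ∈ edgesAtXY → ⊥
    listedOnce ab∈ ba∈ with listed ab∈ | listed ba∈
    ... | inj₁ a≡x , a≢b        | inj₁ b≡x , _        = a≢b (trans a≡x (sym b≡x))
    ... | inj₁ a≡x , _          | inj₂ (_ , a≢x) , _  = a≢x a≡x
    ... | inj₂ (_ , b≢x) , _    | inj₁ b≡x , _        = b≢x b≡x
    ... | inj₂ (a≡y , _) , a≢b  | inj₂ (b≡y , _) , _  = a≢b (trans a≡y (sym b≡y))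

    hitsOne : ∀ f {e e′} → e ∈ edgesAtXY → e′ ∈ edgesAtXY → SameEdge f e → SameEdge f e′ → e ≡ e′
    hitsOne _ _  _   (inj₁ (refl , refl)) (inj₁ (refl , refl)) = refl
    hitsOne _ e∈ e′∈ (inj₁ (refl , refl)) (inj₂ (refl , refl)) = ⊥-elim (listedOnce e∈ e′∈)
    hitsOne _ e∈ e′∈ (inj₂ (refl , refl)) (inj₁ (refl , refl)) = ⊥-elim (listedOnce e∈ e′∈)
    hitsOne _ _  _   (inj₂ (refl , refl)) (inj₂ (refl , refl)) = refl

    edgesAtXY-unique : Unique edgesAtXY
    edgesAtXY-unique =
      Unique.++⁺ (Unique.map⁺ (λ eq → toggle-injective _ _ x (cong proj₂ eq)) (Unique.allFin⁺ M))
                 (Unique.map⁺ (λ eq → toggle-injective _ _ y (cong proj₂ eq)) (Unique.filter⁺ notToX? (Unique.allFin⁺ M)))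
                 λ (e∈X , e∈Y) → atX∩atY e∈X e∈Y
      where
      atX∩atY : ∀ {e} → e ∈ edgesAtX → e ∈ edgesAtY → ⊥
      atX∩atY e∈X e∈Y with _ , _ , refl ← ∈-map⁻ (λ i → x , toggle i x) e∈X
                         | _ , _ , eq ← ∈-map⁻ (λ i → y , toggle i y) e∈Y = x≢y (cong proj₁ eq)

    length-edgesAtXY : M + M ≤ suc (length edgesAtXY)
    length-edgesAtXY = begin
      M + M                   ≡⟨ cong (_+ M) (sym |allFin|) ⟩
      length (allFin M) + M   ≤⟨ +-monoʳ-≤ (length (allFin M)) (≤-trans (≤-reflexive (sym |allFin|))
                                   (length≤1+filter notToX? (allFin M) (Unique.allFin⁺ M) towardXOnce)) ⟩
      length (allFin M) + suc (length (filter notToX? (allFin M)))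
                              ≡⟨ +-suc _ _ ⟩
      suc (length (allFin M) + length (filter notToX? (allFin M)))
                              ≡⟨ cong suc (cong₂ _+_ (length-map _ (allFin M)) (length-map _ (filter notToX? (allFin M)))) ⟨
      suc (length edgesAtX + length edgesAtY)
                              ≡⟨ cong suc (length-++ edgesAtX) ⟨
      suc (length edgesAtXY)  ∎
      where
      open ≤-Reasoning
      |allFin| : length (allFin M) ≡ M
      |allFin| = length-tabulate (λ i → i)
      towardXOnce : ∀ {i k} → i ∈ allFin M → k ∈ allFin M → ¬ toggle i y ≢ x → ¬ toggle k y ≢ x → i ≡ k
      towardXOnce {i} {k} _ _ ¬¬i ¬¬k with toggle i y ≟ⱽ x | toggle k y ≟ⱽ x
      ... | yes iy≡x | yes ky≡x = toggle-injective i k y (trans iy≡x (sym ky≡x))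
      ... | no iy≢x  | _        = ⊥-elim (¬¬i iy≢x)
      ... | _        | no ky≢x  = ⊥-elim (¬¬k ky≢x)

  -- At least 2M − 1 edges are incident to x or y, and a single fault hits at most one of them.
  twoIsolated⇒manyFaults : ∀ (F : List (Pair M)) → Isolated F x → Isolated F y → ¬ suc (suc (length F)) ≤ M + M
  twoIsolated⇒manyFaults F isoX isoY 2+|F|≤2M
    with e , e∈ , unhit ← pigeonhole SameEdge sameEdge? edgesAtXY edgesAtXY-unique F hitsOne
                            (≤-pred (≤-trans 2+|F|≤2M length-edgesAtXY))
       | ∈-++⁻ edgesAtX e∈
  ... | inj₁ e∈X with i , _ , refl ← ∈-map⁻ (λ i → x , toggle i x) e∈X =
    let f , f∈F , same = Faulty⇒∃SameEdge (isoX i) in unhit f f∈F same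
  ... | inj₂ e∈Y with i , _ , refl ← ∈-map⁻ (λ i → y , toggle i y) e∈Y =
    let f , f∈F , same = Faulty⇒∃SameEdge (isoY i) in unhit f f∈F same

notIsolated⇒free : ∀ {n} {F : List (Pair n)} {t} → ¬ Isolated F t → ∃ λ i → ¬ Faulty F t (toggle i t)
notIsolated⇒free {n} {F} {t} ¬iso = ¬∀⟶∃¬ n (λ i → Faulty F t (toggle i t)) (λ i → Faulty? F t (toggle i t)) ¬iso

isolated? : ∀ {n} (F : List (Pair n)) t → Dec (Isolated F t)
isolated? F t = all? (λ i → Faulty? F t (toggle i t))

anyVertex? : ∀ {n} {P : Vertex n → Set} → (∀ x → Dec (P x)) → Dec (∃ P)
anyVertex? {zero} P? with P? []
... | yes p = yes ([] , p)
... | no ¬p = no λ { ([] , p) → ¬p p }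
anyVertex? {suc n} P? with anyVertex? (λ x → P? (false ∷ x)) | anyVertex? (λ x → P? (true ∷ x))
... | yes (x , p) | _           = yes (false ∷ x , p)
... | no _        | yes (x , p) = yes (true ∷ x , p)
... | no ¬p₀      | no ¬p₁      = no λ { (false ∷ x , p) → ¬p₀ (x , p) ; (true ∷ x , p) → ¬p₁ (x , p) }

module _ {n} {F : List (Pair n)} {x b} (isoX : Isolated F x) (P : MatchingInvolution (removeEdge (x , b) F)) where
  open MatchingInvolution P

  isolated⇒partner : partner x ≡ b
  isolated⇒partner with i , px≡xi ← Adj⇒toggle x (partner x) (adjacent x)
    with Faulty-removeEdge {e = x , b} (isoX i)
  ... | inj₁ fault              = ⊥-elim (fault-free x (subst (Faulty _ x) (sym px≡xi) fault))
  ... | inj₂ (inj₁ (_ , xi≡b))  = trans px≡xi xi≡b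
  ... | inj₂ (inj₂ (_ , xi≡x))  = ⊥-elim (toggle-≢ i x xi≡x)

ConditionallyMatchable : ℕ → Set
ConditionallyMatchable n = ∀ (F : List (Pair n)) → suc (suc (suc (length F))) ≤ n + n → NoIsolatedVertex F →
                           MatchingInvolution F

heavy⇒rest< : ∀ {M a r} → M ≤ a → a + r < M + M → r < M
heavy⇒rest< {M} {a} {r} M≤a a+r<2M = +-cancelˡ-< M r M (≤-<-trans (+-monoˡ-≤ r M≤a) a+r<2M)

tight⇒counts : ∀ a b c {n} → a + (b + c) < n → n ≤ suc (suc a) → 0 < c → b ≡ 0 × c ≡ 1
tight⇒counts a b c sum<n n≤2+a 0<c with b + c ≤? 1
... | no  b+c≰1 = ⊥-elim (b+c≰1 (+-cancelˡ-≤ a (b + c) 1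
                    (subst (a + (b + c) ≤_) (sym (+-comm a 1)) (≤-pred (<-≤-trans sum<n n≤2+a)))))
... | yes b+c≤1 with b | c
...   | zero  | suc zero    = refl , refl
...   | zero  | suc (suc _) = ⊥-elim (<⇒≱ (s≤s (s≤s z≤n)) b+c≤1)
...   | suc b′ | suc c′     with () ← subst (_≤ 0) (+-suc b′ c′) (≤-pred b+c≤1)
...   | _     | zero        = ⊥-elim (<-irrefl refl 0<c)

-- With at least M faults in the lower half, fewer than M are left for the upper half and the cross edges.
-- A vertex isolated in the lower half is matched across together with a suitable neighbour; otherwise
-- induction applies to the lower half, except when it carries 2M − 2 faults, where one of them is set aside first.
module HeavyLowerHalf {M} (ih : ConditionallyMatchable M) (F : List (Pair (suc M)))
  (3+|F|≤ : suc (suc (suc (length F))) ≤ suc M + suc M) (noIso : NoIsolatedVertex F)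
  (0<C : 0 < length (crossFaults F)) (heavy : M ≤ length (lowerFaults F)) where

  private
    F₀ = lowerFaults F
    A  = length (lowerFaults F)
    B  = length (upperFaults F)
    C  = length (crossFaults F)

    split< : A + (B + C) < M + M
    split< = subst (_< M + M) (length-split F)
      (≤-pred (≤-pred (subst (suc (suc (suc (length F))) ≤_) (cong suc (+-suc M M)) 3+|F|≤)))

    rest< : B + C < M
    rest< = heavy⇒rest< heavy split<

    2+B≤M : suc (suc B) ≤ M
    2+B≤M = proj₂ (<-summands 0 B rest< 0<C)

    B<M : B < M
    B<M = <-trans (n<1+n B) 2+B≤M

    2+A≤2M : suc (suc A) ≤ M + M
    2+A≤2M = proj₁ (<-summands A B split< 0<C)

    3+removed≤ : ∀ {u v} → Faulty F₀ u v → suc (suc (suc (length (removeEdge (u , v) F₀)))) ≤ M + M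
    3+removed≤ fault = ≤-trans (s≤s (s≤s (length-removeEdge fault))) 2+A≤2M

    noIso-removeEdge : ∀ {e} → NoIsolatedVertex F₀ → NoIsolatedVertex (removeEdge e F₀)
    noIso-removeEdge noIso₀ t = let i , free = noIso₀ t in i , free ∘ Faulty-removeEdge⁻

  withIsolated : ∀ x → Isolated F₀ x → MatchingInvolution F
  withIsolated x isoX
    with j , _ , ¬f₁ , ¬fc ← freeSquare x (nonLowerFaults F) (subst (_< M) (sym (length-nonLowerFaults F)) rest<) =
    proj₁ (reroute F crossAtX crossAtB (P₀ , isolated⇒partner isoX P₀) P₁)
    where
    b = toggle j x
    crossAtX : ¬ Faulty F (false ∷ x) (true ∷ x)
    crossAtX with noIso (false ∷ x)
    ... | zero  , free = free
    ... | suc i , free = ⊥-elim (free (Faulty-lowerFaults⁻ (isoX i)))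
    crossAtB : ¬ Faulty F (false ∷ b) (true ∷ b)
    crossAtB fault = ¬fc (Faulty-sym (nonLowerFaults F) (Faulty-nonLowerFaults⁺ (Faulty-sym F fault)))
    noIso′ : NoIsolatedVertex (removeEdge (x , b) F₀)
    noIso′ t with t ≟ⱽ x
    ... | yes refl = j , removeEdge-removes {F = F₀}
    ... | no  t≢x  = let i , free = notIsolated⇒free (λ isoT → twoIsolated⇒manyFaults t≢x F₀ isoT isoX 2+A≤2M) in
                     i , free ∘ Faulty-removeEdge⁻
    P₀ = ih (removeEdge (x , b) F₀) (3+removed≤ (isoX j)) noIso′
    P₁ = fewFaults⇒matchingThrough M (upperFaults F) x b 2+B≤M (Adj-toggle j x)
           (¬f₁ ∘ Faulty-nonLowerFaults⁺ ∘ Faulty-upperFaults⁻ {F = F})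

  module Tight (noIso₀ : NoIsolatedVertex F₀) (B≡0 : B ≡ 0) {e} (cross≡ : crossFaults F ≡ e ∷ []) where
    private
      CrossFaulty : Vertex M → Set
      CrossFaulty t = Faulty F (false ∷ t) (true ∷ t)

      c : Vertex M
      c = tail (proj₁ e)

      onlyCrossFault : ∀ {f} → f ∈ crossFaults F → f ≡ e
      onlyCrossFault f∈ with here f≡e ← subst (_ ∈_) cross≡ f∈ = f≡e

      crossFaulty⇒c : ∀ {t} → CrossFaulty t → t ≡ c
      crossFaulty⇒c (inj₁ e∈) = cong (tail ∘ proj₁) (onlyCrossFault (∈-crossFaults⁺ {F = F} {h = false} e∈))
      crossFaulty⇒c (inj₂ e∈) = cong (tail ∘ proj₁) (onlyCrossFault (∈-crossFaults⁺ {F = F} {h = true} e∈))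

      noUpper : ∀ {u v} → ¬ Faulty (upperFaults F) u v
      noUpper (inj₁ e∈) = ∈⇒length≢0 e∈ B≡0
      noUpper (inj₂ e∈) = ∈⇒length≢0 e∈ B≡0

      CrossFree : Pair M → Set
      CrossFree (u , v) = ¬ CrossFaulty u × ¬ CrossFaulty v

      crossFree? : ∀ g → Dec (CrossFree g)
      crossFree? (u , v) = ¬? (Faulty? F (false ∷ u) (true ∷ u)) ×-dec ¬? (Faulty? F (false ∷ v) (true ∷ v))

      extend : ∀ {u v} → CrossFree (u , v) → MatchingInvolution (removeEdge (u , v) F₀) → MatchingInvolution F
      extend {u} {v} (¬cu , ¬cv) P₀ with MatchingInvolution.partner P₀ u ≟ⱽ v
      ... | yes p₀u≡v = proj₁ (reroute F ¬cu ¬cv (P₀ , p₀u≡v)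
                          (fewFaults⇒matchingThrough M (upperFaults F) u v 2+B≤M
                            (subst (Adj u) p₀u≡v (MatchingInvolution.adjacent P₀ u)) noUpper))
      ... | no  p₀u≢v = combine F (restoreEdge P₀ p₀u≢v) (fewFaults⇒matching M (upperFaults F) B<M)

      removingLowerFault : ∀ {g} → g ∈ F₀ → CrossFree g → MatchingInvolution F
      removingLowerFault {u , v} uv∈ crossFree =
        extend crossFree (ih (removeEdge (u , v) F₀) (3+removed≤ (inj₁ uv∈)) (noIso-removeEdge noIso₀))

      F₀-nonempty : ∃ (_∈ F₀)
      F₀-nonempty = 0<length⇒∃∈ (<-≤-trans (<-trans z<s 2+B≤M) heavy)

    matching : MatchingInvolution F
    matching with noIso (false ∷ c)
    ... | zero , ¬fc = removingLowerFault g∈ (crossFree _ , crossFree _)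
      where
      g∈ = proj₂ F₀-nonempty
      crossFree : ∀ t → ¬ CrossFaulty t
      crossFree t fault = ¬fc (subst CrossFaulty (crossFaulty⇒c fault) fault)
    ... | suc j , ¬fj with any? crossFree? F₀
    ...   | yes found = let _ , g∈ , crossFree = find found in removingLowerFault g∈ crossFree
    ...   | no  none  = combine F (toggleMatching j toggleFree) (fewFaults⇒matching M (upperFaults F) B<M)
      where
      -- Every lower fault has a cross-faulty endpoint, and c is the only such vertex.
      touchesC : ∀ {u v} → (u , v) ∈ F₀ → u ≡ c ⊎ v ≡ c
      touchesC {u} {v} uv∈ with Faulty? F (false ∷ u) (true ∷ u) | Faulty? F (false ∷ v) (true ∷ v)
      ... | yes cu | _      = inj₁ (crossFaulty⇒c cu)
      ... | no  _  | yes cv = inj₂ (crossFaulty⇒c cv)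
      ... | no ¬cu | no ¬cv = ⊥-elim (none (lose uv∈ (¬cu , ¬cv)))
      fault-freeAtC : ∀ {t} → t ≡ c ⊎ toggle j t ≡ c → ¬ Faulty F₀ t (toggle j t)
      fault-freeAtC (inj₁ refl)       fault = ¬fj (Faulty-lowerFaults⁻ fault)
      fault-freeAtC {t} (inj₂ tj≡c)   fault =
        ¬fj (Faulty-lowerFaults⁻ (subst₂ (Faulty F₀) tj≡c t≡jc (Faulty-sym F₀ fault)))
        where
        t≡jc : t ≡ toggle j c
        t≡jc = trans (sym (toggle-involutive j t)) (cong (toggle j) tj≡c)
      toggleFree : ∀ t → ¬ Faulty F₀ t (toggle j t)
      toggleFree t (inj₁ e∈) = fault-freeAtC (touchesC e∈) (inj₁ e∈)
      toggleFree t (inj₂ e∈) = fault-freeAtC ([ inj₂ , inj₁ ] (touchesC e∈)) (inj₂ e∈)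

  withoutIsolated : NoIsolatedVertex F₀ → MatchingInvolution F
  withoutIsolated noIso₀ with suc (suc (suc A)) ≤? M + M
  ... | yes 3+A≤2M = combine F (ih F₀ 3+A≤2M noIso₀) (fewFaults⇒matching M (upperFaults F) B<M)
  ... | no  3+A≰2M with B≡0 , C≡1 ← tight⇒counts A B C split< (≤-pred (≰⇒> 3+A≰2M)) 0<C
                    with e , cross≡ ← length≡1⇒singleton (crossFaults F) C≡1 =
    Tight.matching noIso₀ B≡0 cross≡

  matching : MatchingInvolution F
  matching with anyVertex? (isolated? F₀)
  ... | yes (x , isoX)  = withIsolated x isoX
  ... | no  noIsolated  = withoutIsolated (λ t → notIsolated⇒free (λ isoT → noIsolated (t , isoT)))

conditionallyMatchable : ∀ n → ConditionallyMatchable n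
conditionallyMatchable zero    F ()
conditionallyMatchable (suc M) F 3+|F|≤ noIso with length (crossFaults F) ≟ 0
... | yes none = matchAcross F none
... | no  some with M ≤? length (lowerFaults F)
...   | yes heavy₀ = HeavyLowerHalf.matching (conditionallyMatchable M) F 3+|F|≤ noIso (n≢0⇒n>0 some) heavy₀
...   | no  light₀ with M ≤? length (upperFaults F)
...     | yes heavy₁ = unreflect (HeavyLowerHalf.matching (conditionallyMatchable M) (reflectFaults F)
                         (subst (λ l → suc (suc (suc l)) ≤ suc M + suc M) (sym (length-reflectFaults F)) 3+|F|≤)
                         (NoIsolatedVertex-reflect noIso)
                         (subst (0 <_) (sym (length-crossFaults-reflect F)) (n≢0⇒n>0 some)) heavy₁)
...     | no  light₁ = combine F (fewFaults⇒matching M (lowerFaults F) (≰⇒> light₀))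
                                 (fewFaults⇒matching M (upperFaults F) (≰⇒> light₁))

otherElement : ∀ {n} {xs : List (Vertex n)} → Unique xs → 2 ≤ length xs → ∀ x → ∃ λ y → y ∈ xs × y ≢ x
otherElement {xs = a ∷ b ∷ _} ((a≢b ∷ _) ∷ _) _ x with a ≟ⱽ x
... | yes refl = b , there (here refl) , a≢b ∘ sym
... | no  a≢x  = a , here refl , a≢x
otherElement {xs = _ ∷ []} _ (s≤s ()) _

components⇒noIsolated : ∀ {n} {F : List (Pair n)} {k} → 2 ≤ k → AllComponentsAtLeast F k → NoIsolatedVertex F
components⇒noIsolated 2≤k comps x
  with L , L! , k≤|L| , reachable ← comps x
  with y , y∈L , y≢x ← otherElement L! (≤-trans 2≤k k≤|L|) x
  with All.lookup reachable y∈L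
... | ε                 = ⊥-elim (y≢x refl)
... | (xz , ¬fxz) ◅ _   with i , refl ← Adj⇒toggle x _ xz = i , ¬fxz

∸2≰⇒3+≤ : ∀ l k → ¬ k ∸ 2 ≤ l → suc (suc (suc l)) ≤ k
∸2≰⇒3+≤ l (suc (suc k)) k≰l = s≤s (s≤s (≰⇒> k≰l))
∸2≰⇒3+≤ l 0             0≰l = ⊥-elim (0≰l z≤n)
∸2≰⇒3+≤ l 1             0≰l = ⊥-elim (0≰l z≤n)

lowerBound : ∀ n s → 1 ≤ s → ∀ F → IsSRMPSet n s F → 2 * n ∸ 2 ≤ length F
lowerBound n s 1≤s F (_ , noPM , _ , comps) with 2 * n ∸ 2 ≤? length F
... | yes enough = enough
... | no  short  = ⊥-elim (noPM (involution⇒perfectMatching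
                     (conditionallyMatchable n F 3+|F|≤2n (components⇒noIsolated (s≤s 1≤s) comps))))
  where
  3+|F|≤2n : suc (suc (suc (length F))) ≤ n + n
  3+|F|≤2n = subst (suc (suc (suc (length F))) ≤_) (cong (n +_) (+-identityʳ n)) (∸2≰⇒3+≤ (length F) (2 * n) short)

module _ {A : Set} where

  count : {P : A → Set} → (∀ x → Dec (P x)) → List A → ℕ
  count P? xs = length (filter P? xs)

  count-≐ : ∀ {P Q : A → Set} (P? : ∀ x → Dec (P x)) (Q? : ∀ x → Dec (Q x)) →
            (∀ {x} → P x → Q x) → (∀ {x} → Q x → P x) → ∀ xs → count P? xs ≡ count Q? xs
  count-≐ P? Q? P⊆Q Q⊆P xs = cong length (filter-≐ P? Q? (P⊆Q , Q⊆P) xs)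

  count-⊎ : ∀ {P Q : A → Set} (P? : ∀ x → Dec (P x)) (Q? : ∀ x → Dec (Q x)) → (∀ {x} → P x → Q x → ⊥) →
            ∀ xs → count (λ x → P? x ⊎-dec Q? x) xs ≡ count P? xs + count Q? xs
  count-⊎ P? Q? disjoint []       = refl
  count-⊎ P? Q? disjoint (x ∷ xs) with P? x | Q? x
  ... | yes p | yes q = ⊥-elim (disjoint p q)
  ... | yes _ | no  _ = cong suc (count-⊎ P? Q? disjoint xs)
  ... | no  _ | yes _ = trans (cong suc (count-⊎ P? Q? disjoint xs)) (sym (+-suc _ _))
  ... | no  _ | no  _ = count-⊎ P? Q? disjoint xs

  count+count-∁ : ∀ {P : A → Set} (P? : ∀ x → Dec (P x)) xs → count P? xs + count (¬? ∘ P?) xs ≡ length xs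
  count+count-∁ P? []       = refl
  count+count-∁ P? (x ∷ xs) with P? x
  ... | yes _ = cong suc (count+count-∁ P? xs)
  ... | no  _ = trans (+-suc _ _) (cong suc (count+count-∁ P? xs))

  count-≡ : (_≟_ : ∀ (x y : A) → Dec (x ≡ y)) → ∀ {a xs} → Unique xs → a ∈ xs → count (_≟ a) xs ≡ 1
  count-≡ _≟_ {a} {x ∷ xs} (x∉xs ∷ xs!) a∈ with x ≟ a | a∈
  ... | yes refl | _         = cong suc (cong length (filter-none (_≟ a) (All.map (λ a≢y y≡a → a≢y (sym y≡a)) x∉xs)))
  ... | no  x≢a  | here a≡x  = ⊥-elim (x≢a (sym a≡x))
  ... | no  _    | there a∈′ = count-≡ _≟_ xs! a∈′

1+m+m≢n+n : ∀ m n → suc (m + m) ≢ n + n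
1+m+m≢n+n zero    (suc n) eq with () ← trans (suc-injective eq) (+-suc n n)
1+m+m≢n+n (suc m) (suc n) eq = 1+m+m≢n+n m n (suc-injective (begin
  suc (suc (m + m))  ≡⟨ cong suc (+-suc m m) ⟨
  suc (m + suc m)    ≡⟨ suc-injective eq ⟩
  n + suc n          ≡⟨ +-suc n n ⟩
  suc (n + n)        ∎))
  where open ≡-Reasoning

module _ {n : ℕ} where

  incident? : ∀ (e : Pair n) x → Dec (Incident x e)
  incident? (a , b) x = (x ≟ⱽ a) ⊎-dec (x ≟ⱽ b)

  covered? : ∀ (M : List (Pair n)) x → Dec (Covered M x)
  covered? M x = any? (λ e → incident? e x) M

  private
    V = allVertices n

  count-incident : ∀ {a b} → a ≢ b → count (incident? (a , b)) V ≡ 2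
  count-incident {a} {b} a≢b =
    trans (count-⊎ (_≟ⱽ a) (_≟ⱽ b) (λ x≡a x≡b → a≢b (trans (sym x≡a) x≡b)) V)
          (cong₂ _+_ (count-≡ _≟ⱽ_ (allVertices-unique n) (∈-allVertices a))
                     (count-≡ _≟ⱽ_ (allVertices-unique n) (∈-allVertices b)))

  count-covered : ∀ (M : List (Pair n)) → All (λ e → Adj (proj₁ e) (proj₂ e)) M → AllPairs Disjoint M →
                  count (covered? M) V ≡ length M + length M
  count-covered []            _          _              = cong length (filter-none (covered? []) (All.universal (λ _ ()) V))
  count-covered ((a , b) ∷ M) (ab ∷ adjs) (disj ∷ disjs) = begin
    count (covered? ((a , b) ∷ M)) V
      ≡⟨ count-≐ (covered? _) (λ x → incident? (a , b) x ⊎-dec covered? M x) uncons recons V ⟩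
    count (λ x → incident? (a , b) x ⊎-dec covered? M x) V
      ≡⟨ count-⊎ (incident? (a , b)) (covered? M) (λ inc cov → notTwice disj inc cov) V ⟩
    count (incident? (a , b)) V + count (covered? M) V
      ≡⟨ cong₂ _+_ (count-incident (Adj⇒≢ ab)) (count-covered M adjs disjs) ⟩
    2 + (length M + length M)
      ≡⟨ cong suc (+-suc (length M) (length M)) ⟨
    suc (length M) + suc (length M)  ∎
    where
    open ≡-Reasoning
    uncons : ∀ {x} → Covered ((a , b) ∷ M) x → Incident x (a , b) ⊎ Covered M x
    uncons (here inc)  = inj₁ inc
    uncons (there cov) = inj₂ cov
    recons : ∀ {x} → Incident x (a , b) ⊎ Covered M x → Covered ((a , b) ∷ M) x
    recons (inj₁ inc) = here inc
    recons (inj₂ cov) = there cov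
    notTwice : ∀ {x M′} → All (Disjoint (a , b)) M′ → Incident x (a , b) → ¬ Covered M′ x
    notTwice ((a≢c , _ , _ , _) ∷ _) (inj₁ refl) (here (inj₁ refl)) = a≢c refl
    notTwice ((_ , a≢d , _ , _) ∷ _) (inj₁ refl) (here (inj₂ refl)) = a≢d refl
    notTwice ((_ , _ , b≢c , _) ∷ _) (inj₂ refl) (here (inj₁ refl)) = b≢c refl
    notTwice ((_ , _ , _ , b≢d) ∷ _) (inj₂ refl) (here (inj₂ refl)) = b≢d refl
    notTwice (_ ∷ disj′)             inc         (there cov)          = notTwice disj′ inc cov

noAlmostPerfectMatching : ∀ n (F : List (Pair (suc n))) → ¬ HasAlmostPerfectMatching F
noAlmostPerfectMatching n F (M , (adjs , disjs) , x₀ , ¬cov₀ , cov) = 1+m+m≢n+n (length M) (2 ^ n) (begin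
  suc (length M + length M)         ≡⟨ cong suc (count-covered M (All.map proj₁ adjs) disjs) ⟨
  suc (count (covered? M) V)        ≡⟨ cong suc (count-≐ (covered? M) ≢x₀? coveredOnlyBy≢x₀ (cov _) V) ⟩
  suc (count ≢x₀? V)                ≡⟨ cong (_+ count ≢x₀? V) (count-≡ _≟ⱽ_ (allVertices-unique (suc n)) (∈-allVertices x₀)) ⟨
  count (_≟ⱽ x₀) V + count ≢x₀? V    ≡⟨ count+count-∁ (_≟ⱽ x₀) V ⟩
  length V                          ≡⟨ length-allVertices (suc n) ⟩
  2 ^ suc n                         ≡⟨ cong (2 ^ n +_) (+-identityʳ (2 ^ n)) ⟩
  2 ^ n + 2 ^ n                     ∎)
  where
  open ≡-Reasoning
  V = allVertices (suc n)
  ≢x₀? = ¬? ∘ (_≟ⱽ x₀)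
  coveredOnlyBy≢x₀ : ∀ {x} → Covered M x → x ≢ x₀
  coveredOnlyBy≢x₀ covX refl = ¬cov₀ covX

AdjMinus-sym : ∀ {n} (F : List (Pair n)) {x y} → AdjMinus F x y → AdjMinus F y x
AdjMinus-sym F {x} {y} (xy , ¬fxy) = Adj-sym {x = x} {y} xy , ¬fxy ∘ Faulty-sym F

module _ {A : Set} {R : A → A → Set} where

  twoWitnesses : ∀ {P Q : A → Set} {xs} → AllPairs R xs → Any P xs → Any Q xs →
                 (∃ λ x → P x × Q x) ⊎ (∃₂ λ x y → P x × Q y × (R x y ⊎ R y x))
  twoWitnesses (_ ∷ _)  (here p)  (here q)  = inj₁ (_ , p , q)
  twoWitnesses (r ∷ _)  (here p)  (there q) = let rxy , qy = All.lookupAny r q in inj₂ (_ , _ , p , qy , inj₁ rxy)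
  twoWitnesses (r ∷ _)  (there p) (here q)  = let ryx , py = All.lookupAny r p in inj₂ (_ , _ , py , q , inj₂ ryx)
  twoWitnesses (_ ∷ rs) (there p) (there q) = twoWitnesses rs p q

All-Any-zip : ∀ {A : Set} {P Q : A → Set} {xs} → All P xs → Any Q xs → Any (λ x → P x × Q x) xs
All-Any-zip (p ∷ _)  (here q)  = here (p , q)
All-Any-zip (_ ∷ ps) (there q) = there (All-Any-zip ps q)

module _ {n} {F : List (Pair n)} {u v w : Vertex n} (u≢v : u ≢ v)
  (onlyWu : ∀ {y} → AdjMinus F u y → y ≡ w) (onlyWv : ∀ {y} → AdjMinus F v y → y ≡ w) where

  private
    edgeToW : ∀ {x} → (∀ {y} → AdjMinus F x y → y ≡ w) →
              ∀ {a b} → AdjMinus F a b × Incident x (a , b) → SameEdge (a , b) (x , w)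
    edgeToW only (xy , inj₁ refl) = inj₁ (refl , only xy)
    edgeToW only (yx , inj₂ refl) = inj₂ (only (AdjMinus-sym F yx) , refl)

    sameEdge⇒≡ : ∀ {a b} → SameEdge (a , b) (u , w) → SameEdge (a , b) (v , w) → ⊥
    sameEdge⇒≡ (inj₁ (a≡u , _))   (inj₁ (a≡v , _))   = u≢v (trans (sym a≡u) a≡v)
    sameEdge⇒≡ (inj₁ (a≡u , b≡w)) (inj₂ (a≡w , b≡v)) = u≢v (trans (sym a≡u) (trans a≡w (trans (sym b≡w) b≡v)))
    sameEdge⇒≡ (inj₂ (a≡w , b≡u)) (inj₁ (a≡v , b≡w)) = u≢v (trans (sym b≡u) (trans b≡w (trans (sym a≡w) a≡v)))
    sameEdge⇒≡ (inj₂ (_ , b≡u))   (inj₂ (_ , b≡v))   = u≢v (trans (sym b≡u) b≡v)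

    disjoint⇒¬shareW : ∀ {a b c d x y} → Disjoint (a , b) (c , d) → SameEdge (a , b) (x , w) → SameEdge (c , d) (y , w) → ⊥
    disjoint⇒¬shareW (_ , _ , _ , b≢d) (inj₁ (_ , refl)) (inj₁ (_ , refl)) = b≢d refl
    disjoint⇒¬shareW (_ , _ , b≢c , _) (inj₁ (_ , refl)) (inj₂ (refl , _)) = b≢c refl
    disjoint⇒¬shareW (_ , a≢d , _ , _) (inj₂ (refl , _)) (inj₁ (_ , refl)) = a≢d refl
    disjoint⇒¬shareW (a≢c , _ , _ , _) (inj₂ (refl , _)) (inj₂ (refl , _)) = a≢c refl

  -- u and v would both have to be matched to w.
  sharedOnlyNeighbour⇒noPerfectMatching : ¬ HasPerfectMatching F
  sharedOnlyNeighbour⇒noPerfectMatching (M , (adjs , disjs) , cov)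
    with twoWitnesses disjs (All-Any-zip adjs (cov u)) (All-Any-zip adjs (cov v))
  ... | inj₁ (_ , atU , atV)              = sameEdge⇒≡ (edgeToW onlyWu atU) (edgeToW onlyWv atV)
  ... | inj₂ (_ , _ , atU , atV , inj₁ d) = disjoint⇒¬shareW d (edgeToW onlyWu atU) (edgeToW onlyWv atV)
  ... | inj₂ (_ , _ , atU , atV , inj₂ d) = disjoint⇒¬shareW d (edgeToW onlyWv atV) (edgeToW onlyWu atU)

starExcept : ∀ {n} → Vertex (suc n) → Fin (suc n) → List (Pair (suc n))
starExcept {n} x i = map (λ j → x , toggle (punchIn i j) x) (allFin n)

module _ {n} (x : Vertex (suc n)) (i : Fin (suc n)) where

  length-starExcept : length (starExcept x i) ≡ n
  length-starExcept = trans (length-map _ (allFin n)) (length-tabulate (λ j → j))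

  ∈-starExcept⁺ : ∀ {d} → i ≢ d → (x , toggle d x) ∈ starExcept x i
  ∈-starExcept⁺ {d} i≢d = subst (λ d′ → (x , toggle d′ x) ∈ starExcept x i) (punchIn-punchOut i≢d)
                            (∈-map⁺ (λ j → x , toggle (punchIn i j) x) (∈-allFin (punchOut i≢d)))

  ∈-starExcept⁻ : ∀ {e} → e ∈ starExcept x i → ∃ λ j → e ≡ (x , toggle (punchIn i j) x)
  ∈-starExcept⁻ e∈ with j , _ , e≡ ← ∈-map⁻ (λ j → x , toggle (punchIn i j) x) e∈ = j , e≡

  toggle∉starExcept : ¬ (x , toggle i x) ∈ starExcept x i
  toggle∉starExcept e∈ with j , e≡ ← ∈-starExcept⁻ e∈ =
    punchInᵢ≢i i j (sym (toggle-injective i (punchIn i j) x (cong proj₂ e≡)))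

  starExcept-onlyNeighbour : ∀ {F y} → (∀ {e} → e ∈ starExcept x i → e ∈ F) → AdjMinus F x y → y ≡ toggle i x
  starExcept-onlyNeighbour star⊆F (xy , ¬fxy) with d , refl ← Adj⇒toggle x _ xy with i ≟ᶠ d
  ... | yes refl = refl
  ... | no  i≢d  = ⊥-elim (¬fxy (inj₁ (star⊆F (∈-starExcept⁺ i≢d))))

  starExcept-edges : IsEdgeSet (starExcept x i)
  starExcept-edges =
    All.map⁺ (All.universal (λ j → Adj-toggle (punchIn i j) x) (allFin n)) ,
    AllPairs.map⁺ (AllPairs.map distinct (Unique.allFin⁺ n))
    where
    distinct : ∀ {j j′} → j ≢ j′ → ¬ SameEdge (x , toggle (punchIn i j) x) (x , toggle (punchIn i j′) x)
    distinct j≢j′ (inj₁ (_ , eq)) = j≢j′ (punchIn-injective i _ _ (toggle-injective _ _ x eq))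
    distinct j≢j′ (inj₂ (x≡ , _)) = toggle-≢ _ x (sym x≡)

twoStars-edges : ∀ {n} {x y : Vertex (suc n)} {i j} → x ≢ y → ¬ Adj y x → IsEdgeSet (starExcept x i ++ starExcept y j)
twoStars-edges {x = x} {y} {i} {j} x≢y ¬yx =
  All.++⁺ (proj₁ (starExcept-edges x i)) (proj₁ (starExcept-edges y j)) ,
  AllPairs.++⁺ (proj₂ (starExcept-edges x i)) (proj₂ (starExcept-edges y j))
    (All.tabulate λ e∈ → All.tabulate λ f∈ → apart e∈ f∈)
  where
  apart : ∀ {e f} → e ∈ starExcept x i → f ∈ starExcept y j → ¬ SameEdge e f
  apart e∈ f∈ same with _ , refl ← ∈-starExcept⁻ x i e∈ | d , refl ← ∈-starExcept⁻ y j f∈ with same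
  ... | inj₁ (x≡y , _) = x≢y x≡y
  ... | inj₂ (x≡yd , _) = ¬yx (subst (Adj y) (sym x≡yd) (Adj-toggle (punchIn j d) y))


NotAllFalse : ∀ {m} → Vec Bool m → Set
NotAllFalse {m} y = y ≢ replicate m false

ascend : ∀ {m} (z : Vec Bool m) → Star (λ y y′ → Adj y y′ × NotAllFalse y′) z (replicate m true)
ascend []              = ε
ascend {suc m} (c ∷ z) =
  gmap (c ∷_) (λ (yy′ , y′≢0) → Adj-∷ c yy′ , y′≢0 ∘ cong tail) (ascend z) ◅◅ setHead c
  where
  setHead : ∀ c → Star (λ y y′ → Adj y y′ × NotAllFalse y′) (c ∷ replicate m true) (true ∷ replicate m true)
  setHead true  = ε
  setHead false = (Adj-not∷ false (replicate m true) , λ ()) ◅ ε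

module CriticalFaults (k : ℕ) where

  zeros : Vec Bool (suc k)
  zeros = replicate (suc k) false

  u v w top : Vertex (suc (suc (suc k)))
  u   = false ∷ false ∷ zeros
  v   = true ∷ true ∷ zeros
  w   = true ∷ false ∷ zeros
  top = replicate _ true

  -- Only w = toggle zero u = toggle (suc zero) v remains adjacent to u and to v.
  faults : List (Pair (suc (suc (suc k))))
  faults = starExcept u zero ++ starExcept v (suc zero)

  length-faults : length faults ≡ 2 * suc (suc (suc k)) ∸ 2
  length-faults = begin
    length (starExcept u zero ++ starExcept v (suc zero))  ≡⟨ length-++ (starExcept u zero) ⟩
    length (starExcept u zero) + length (starExcept v (suc zero))
                                                          ≡⟨ cong₂ _+_ (length-starExcept u zero) (length-starExcept v (suc zero)) ⟩
    suc (suc k) + suc (suc k)                             ≡⟨ cong (λ l → suc (suc (k + suc (suc l)))) (+-identityʳ k) ⟨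
    suc (suc (k + suc (suc (k + 0))))                     ≡⟨ cong suc (+-suc k _) ⟨
    2 * suc (suc (suc k)) ∸ 2                             ∎
    where open ≡-Reasoning

  faults-edges : IsEdgeSet faults
  faults-edges = twoStars-edges {i = zero} {j = suc zero} (λ ()) (λ ())

  faults-noPerfectMatching : ¬ HasPerfectMatching faults
  faults-noPerfectMatching = sharedOnlyNeighbour⇒noPerfectMatching {u = u} {v} {w} (λ ())
    (starExcept-onlyNeighbour u zero ∈-++⁺ˡ) (starExcept-onlyNeighbour v (suc zero) (∈-++⁺ʳ (starExcept u zero)))

  private
    Good : Vertex (suc (suc (suc k))) → Set
    Good x = x ≢ u × x ≢ v

    fault-source : ∀ {e} → e ∈ faults → proj₁ e ≡ u ⊎ proj₁ e ≡ v
    fault-source e∈ with ∈-++⁻ (starExcept u zero) e∈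
    ... | inj₁ e∈U with _ , refl ← ∈-starExcept⁻ u zero e∈U = inj₁ refl
    ... | inj₂ e∈V with _ , refl ← ∈-starExcept⁻ v (suc zero) e∈V = inj₂ refl

    good⇒fault-free : ∀ {x y} → Adj x y → Good x → Good y → AdjMinus faults x y
    good⇒fault-free xy (x≢u , x≢v) (y≢u , y≢v) = xy , λ
      { (inj₁ xy∈) → [ x≢u , x≢v ] (fault-source xy∈)
      ; (inj₂ yx∈) → [ y≢u , y≢v ] (fault-source yx∈) }

    lift : ∀ {x y} → Good x → Star (λ y y′ → Adj y y′ × Good y′) x y → Reach faults x y
    lift gx ε                  = ε
    lift gx ((xy , gy) ◅ path) = good⇒fault-free xy gx gy ◅ lift gy path

    notAllFalse⇒good : ∀ {a b z} → NotAllFalse z → Good (a ∷ b ∷ z)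
    notAllFalse⇒good z≢0 = z≢0 ∘ cong (tail ∘ tail) , z≢0 ∘ cong (tail ∘ tail)

    -- Raise the last coordinates first: afterwards the vertex can no longer be u or v.
    toTop : ∀ a b z → Star (λ y y′ → Adj y y′ × Good y′) (a ∷ b ∷ z) top
    toTop a b z = gmap (λ y → a ∷ b ∷ y) (λ (yy′ , y′≢0) → Adj-∷ a (Adj-∷ b yy′) , notAllFalse⇒good y′≢0) (ascend z)
                  ◅◅ setSecond a b
      where
      ones = replicate (suc k) true
      ones-good : ∀ {a b} → Good (a ∷ b ∷ ones)
      ones-good = notAllFalse⇒good λ ()
      setFirst : ∀ a → Star (λ y y′ → Adj y y′ × Good y′) (a ∷ true ∷ ones) top
      setFirst true  = ε
      setFirst false = (Adj-toggle zero (false ∷ true ∷ ones) , ones-good) ◅ ε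
      setSecond : ∀ a b → Star (λ y y′ → Adj y y′ × Good y′) (a ∷ b ∷ ones) top
      setSecond a true  = setFirst a
      setSecond a false = (Adj-toggle (suc zero) (a ∷ false ∷ ones) , ones-good) ◅ setFirst a

    w-good : Good w
    w-good = (λ ()) , (λ ())

    uw : AdjMinus faults u w
    uw = Adj-toggle zero u , λ
      { (inj₁ uw∈) → [ toggle∉starExcept u zero , (λ uw∈V → case ∈-starExcept⁻ v (suc zero) uw∈V of λ { (_ , ()) }) ] (∈-++⁻ (starExcept u zero) uw∈)
      ; (inj₂ wu∈) → [ (λ ()) , (λ ()) ] (fault-source wu∈) }

    vw : AdjMinus faults v w
    vw = Adj-toggle (suc zero) v , λ
      { (inj₁ vw∈) → [ (λ vw∈U → case ∈-starExcept⁻ u zero vw∈U of λ { (_ , ()) }) , toggle∉starExcept v (suc zero) ] (∈-++⁻ (starExcept u zero) vw∈)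
      ; (inj₂ wv∈) → [ (λ ()) , (λ ()) ] (fault-source wv∈) }

    reachTop : ∀ x → Reach faults x top
    reachTop (a ∷ b ∷ z) with (a ∷ b ∷ z) ≟ⱽ u | (a ∷ b ∷ z) ≟ⱽ v
    ... | yes refl | _        = uw ◅ lift w-good (toTop true false zeros)
    ... | no  _    | yes refl = vw ◅ lift w-good (toTop true false zeros)
    ... | no  x≢u  | no  x≢v  = lift (x≢u , x≢v) (toTop a b z)

  faults-connected : ∀ x y → Reach faults x y
  faults-connected x y = reachTop x ◅◅ reverse (AdjMinus-sym faults) (reachTop y)

  faults-restricted : ∀ s → s < 2 ^ suc (suc (suc k)) → IsSRMPSet (suc (suc (suc k))) s faults
  faults-restricted s s<2ⁿ =
    faults-edges , faults-noPerfectMatching , noAlmostPerfectMatching (suc (suc k)) faults ,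
    λ x → allVertices n , allVertices-unique n , subst (suc s ≤_) (sym (length-allVertices n)) s<2ⁿ ,
          All.universal (faults-connected x) (allVertices n)
    where n = suc (suc (suc k))

mainTheorem5 : ∀ (n : ℕ) → 3 ≤ n → ∀ (s : ℕ) → 2 ≤ s → s < 2 ^ n → MpEq n s (2 * n ∸ 2)
mainTheorem5 (suc (suc (suc k))) _ s 2≤s s<2ⁿ =
  (faults , faults-restricted s s<2ⁿ , length-faults) ,
  lowerBound (suc (suc (suc k))) s (≤-trans (s≤s z≤n) 2≤s)
  where open CriticalFaults k
mainTheorem5 0             ()
mainTheorem5 1             (s≤s ())
mainTheorem5 2             (s≤s (s≤s ()))
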